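{- Let $1\le i<j\le m$ and let $r$ be an integer. Then: (1) for $0 \leq k < n-1$, \[S^k =\prod_{t = r+k+1}^{r+n-1}x_{j}^{(t+1)}\prod_{t = 1}^{k}\sigma_{(n-1)(j-i)}^{(r-j+i+t)}(\mathbf{x}_i, \dots, \mathbf{x}_{j}) \,P_k^{(r-j+i+k+1)}(\mathbf{x}_i, \dots, \mathbf{x}_{j})\prod_{t = k+2}^{n-1}\sigma_{(n-1)(j-i)}^{(r-j+i+t)}(\mathbf{x}_i, \dots, \mathbf{x}_{j});\] (2) for $0 < k \leq n-1$, \[S_k = \prod_{t = 1}^{k}x_{i}^{(r-j+i+t)}\prod_{t = k+1}^{n-1}\sigma_{(n-1)(j-i)}^{(r-j+i+t)}(\mathbf{x}_i, \dots, \mathbf{x}_{j}) \,P_{n-k-1}^{(r-j+i)}(\mathbf{x}_i, \dots, \mathbf{x}_{j})\prod_{t = 1}^{k-1}\sigma_{(n-1)(j-i)}^{(r-j+i+t)}(\mathbf{x}_i, \dots, \mathbf{x}_{j});\] (3) $S^{n-1} = S_0 = \prod_{t = 1}^{n-1}\sigma_{(n-1)(j-i)}^{(r-j+i+t)}(\mathbf{x}_i, \dots, \mathbf{x}_{j}).$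
   Context: Fix positive integers $n,m$. Let $\mathbf{x}_1,\dots,\mathbf{x}_m$ be vectors of variables, $\mathbf{x}_i=(x_i^{(1)},\dots,x_i^{(n)})$; upper indices are read modulo $n$. Empty products equal $1$. For integers $k\ge0$ and $r$, $\tau_k^{(r)}(\mathbf{x}_1,\dots,\mathbf{x}_m)=\sum x_{i_1}^{(r)}x_{i_2}^{(r-1)}\cdots x_{i_k}^{(r-k+1)}$ over $1\le i_1\le\dots\le i_k\le m$ with no value appearing more than $n-1$ times; $\tau_0^{(r)}=1$, and $\tau_k^{(r)}=0$ if $k<0$ or $k>m(n-1)$ (for an empty list, $\tau_0=1$, $\tau_k=0$ otherwise). $\sigma_k^{(r)}(\mathbf{x}_1,\dots,\mathbf{x}_m)=\sum_{i=0}^k x_1^{(r)}\cdots x_1^{(r-i+1)}\tau_{k-i}^{(r-i)}(\mathbf{x}_2,\dots,\mathbf{x}_m)$; the same function of a consecutive subsequence $\mathbf{x}_i,\dots,\mathbf{x}_j$ is defined after relabeling. For $i<j$ and $k\ge0$ define $P_k^{(r)}(\mathbf{x}_i, \dots, \mathbf{x}_{j}) =\sum_{t = 0}^{k}\prod_{s = 0}^{t-1} x_i^{(r-s)}\; \sigma_{(n-1)(j-i-1)}^{(r-t)}(\mathbf{x}_i, \dots, \mathbf{x}_{j-1})\prod_{s = 0}^{k-t-1} x_{j}^{(r-t+j-i-1-s)}.$ For fixed $i,j,r$ and $0\le s\le n-1$ define $T_s = \prod_{t=r+s+1}^{r+n-1}x_{j}^{(t+1)} \prod_{t = s+2}^{s+n-1}\sigma_{(n-1)(j-i)}^{(r-j+i+t)}(\mathbf{x}_i,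 \dots, \mathbf{x}_{j})\; \sigma_{(n-1)(j-i-1)}^{(r-j+i+s+1)}(\mathbf{x}_i, \dots, \mathbf{x}_{j-1})\prod_{t = 1}^{s}x_i^{(r-j+i+t)},$ and $S^k = \sum_{s=0}^{k}T_s$, $S_k = \sum_{s = k}^{n-1}T_s$. -}

module Defs where

open import Level using (Level)
open import Function using (_∘_)
open import Data.Nat as ℕ using (ℕ; zero; suc; _∸_; _⊓_; NonZero)
open import Data.Integer as ℤ using (ℤ; +_; -[1+_]; _%ℕ_)
open import Data.Integer.DivMod using (n%ℕd<d)
open import Data.Fin using (Fin; fromℕ<)
open import Data.List using (List; []; _∷_; map)
open import Algebra.Bundles using (CommutativeRing)

-- ℤ → ℕ, negative numbers clamped to 0 (number of terms in an integer range)
clamp : ℤ → ℕ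
clamp (+ k)     = k
clamp -[1+ _ ]  = 0

upFrom : ℕ → ℕ → List ℕ
upFrom a zero    = []
upFrom a (suc l) = a ∷ upFrom (suc a) l

module Loop {c ℓ : Level} (R : CommutativeRing c ℓ)
            (n : ℕ) .{{_ : NonZero n}}
            (x : ℕ → Fin n → CommutativeRing.Carrier R) where
  open CommutativeRing R

  VecZ : Set c
  VecZ = ℤ → Carrier

  -- X i r = x_i^{(r)}, upper index read modulo n
  X : ℕ → VecZ
  X i r = x i (fromℕ< (n%ℕd<d r n))

  prodN : ℕ → (ℕ → Carrier) → Carrier
  prodN zero    f = 1#
  prodN (suc l) f = f 0 * prodN l (f ∘ suc)

  sumN : ℕ → (ℕ → Carrier) → Carrier
  sumN zero    f = 0#
  sumN (suc l) f = f 0 + sumN l (f ∘ suc)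

  -- ∏_{t=a}^{b} f t over integers (empty, = 1, if b < a)
  prodZ : ℤ → ℤ → (ℤ → Carrier) → Carrier
  prodZ a b f = prodN (clamp (b ℤ.- a ℤ.+ ℤ.1ℤ)) (λ u → f (a ℤ.+ + u))

  fall : VecZ → ℤ → ℕ → Carrier
  fall v r l = prodN l (λ s → v (r ℤ.- + s))

  -- τ_k^{(r)}(v_1,…,v_p): sum over 1 ≤ i_1 ≤ … ≤ i_k ≤ p with multiplicities ≤ n-1
  -- of v_{i_1}^{(r)} v_{i_2}^{(r-1)} ⋯ ; organised by the multiplicity a of the first vector.
  τ : List VecZ → ℕ → ℤ → Carrier
  τ []       zero    r = 1#
  τ []       (suc k) r = 0#
  τ (v ∷ vs) k       r =
    sumN (suc (k ⊓ (n ∸ 1))) (λ a → fall v r a * τ vs (k ∸ a) (r ℤ.- + a))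

  σ : VecZ → List VecZ → ℕ → ℤ → Carrier
  σ v vs k r = sumN (suc k) (λ a → fall v r a * τ vs (k ∸ a) (r ℤ.- + a))

  σseg : ℕ → ℕ → ℕ → ℤ → Carrier
  σseg i j k r = σ (X i) (map X (upFrom (suc i) (j ∸ i))) k r

  P : ℕ → ℕ → ℕ → ℤ → Carrier
  P i j k r = sumN (suc k) (λ t →
      fall (X i) r t
    * σseg i (j ∸ 1) ((n ∸ 1) ℕ.* (j ∸ i ∸ 1)) (r ℤ.- + t)
    * prodN (k ∸ t) (λ s → X j (r ℤ.- + t ℤ.+ + (j ∸ i ∸ 1) ℤ.- + s)))

  shift : ℕ → ℕ → ℤ → ℤ
  shift i j r = r ℤ.- + j ℤ.+ + i

  T : ℕ → ℕ → ℤ → ℕ → Carrier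
  T i j r s =
      prodZ (r ℤ.+ + s ℤ.+ ℤ.1ℤ) (r ℤ.+ + n ℤ.- ℤ.1ℤ) (λ t → X j (t ℤ.+ ℤ.1ℤ))
    * prodZ (+ s ℤ.+ + 2) (+ s ℤ.+ + n ℤ.- ℤ.1ℤ)
        (λ t → σseg i j ((n ∸ 1) ℕ.* (j ∸ i)) (shift i j r ℤ.+ t))
    * σseg i (j ∸ 1) ((n ∸ 1) ℕ.* (j ∸ i ∸ 1)) (shift i j r ℤ.+ + s ℤ.+ ℤ.1ℤ)
    * prodZ ℤ.1ℤ (+ s) (λ t → X i (shift i j r ℤ.+ t))

  Sup : ℕ → ℕ → ℤ → ℕ → Carrier
  Sup i j r k = sumN (suc k) (T i j r)

  Sdown : ℕ → ℕ → ℤ → ℕ → Carrier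
  Sdown i j r k = sumN (n ∸ k) (λ u → T i j r (k ℕ.+ u))

  σprod : ℕ → ℕ → ℤ → ℤ → ℤ → Carrier
  σprod i j r a b = prodZ a b (λ t → σseg i j ((n ∸ 1) ℕ.* (j ∸ i)) (shift i j r ℤ.+ t))

module Submission where

-- Write x = x_i, y = x_j, d = j - i - 1, ρ(u) = σ^{(u)}_{(n-1)d}(x_i, …, x_{j-1}) and
-- Q(u) = P^{(u)}_{n-1}(x_i, …, x_j).  Splitting off the last vector, and using that τ vanishes
-- above its top degree, gives σ^{(u)}_{(n-1)(j-i)}(x_i, …, x_j) = Q(u); so T_s and all right-hand
-- sides are products of values of Q, ρ, x and y.  These are n-periodic in the upper index, hence a
-- full falling product x^{(u)} ⋯ x^{(u-n+1)} is a constant E_x (likewise E_y).  Peeling the first or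
-- the last term off P_{k+1} gives two recurrences which combine into the exchange identity
--   x^{(p)} Q(p-1) + ρ(p) E_y = y^{(p+d+1)} Q(p) + ρ(p) E_x,
-- and, by induction on k, into
--   Q(q-1) P_{k+1}(q) = y^{(q+d+1)} Q(q) P_k(q-1) + Q(q-k-2) ρ(q) x^{(q-1)} ⋯ x^{(q-k-1)}.
-- This is exactly what turns the right-hand side of (1) for k plus T_{k+1} into the right-hand side
-- for k+1, so (1) holds by induction; at k = n-1 the products wrap around by periodicity, giving (3);
-- and (2) is (3) minus (1), after splitting Q(r-j+i+k+1) at k.

open import Defs
open import Level using (Level)
open import Data.Nat using (ℕ; _≤_; _<_; _∸_; NonZero)
open import Data.Integer as Z using (ℤ; +_; 1ℤ)
open import Data.Fin using (Fin)
open import Data.Product using (_×_)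
open import Algebra.Bundles using (CommutativeRing)
open import Function using (_∘_)
open import Data.Nat using (zero; suc; _⊓_; z≤n; s≤s)
import Data.Nat as ℕ
import Data.Nat.Properties as ℕP
open import Data.Integer using (-[1+_]; 0ℤ)
import Data.Integer.Properties as ZP
open import Data.Integer.DivMod using (n%ℕd<d; a≡a%ℕn+[a/ℕn]*n)
open import Data.Integer.Tactic.RingSolver using (solve-∀)
open import Data.Fin.Properties using (fromℕ<-cong)
open import Data.List using (List; []; _∷_; map; length; _++_)
open import Data.List.Properties using (map-++; length-map)
open import Data.Product using (_,_)
open import Data.Empty using (⊥-elim)
import Data.Empty.Irrelevant as Irrelevant
open import Relation.Nullary using (yes; no; ¬_)
open import Relation.Binary.PropositionalEquality as P using (_≡_)

%ℕ-unique : ∀ {n r₁ r₂} e → r₁ ℕ.< n → r₂ ℕ.< n → + r₁ ≡ + r₂ Z.+ e Z.* + n → r₁ ≡ r₂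
%ℕ-unique {n} {r₁} {r₂} (+ zero)  _    _    eq = P.trans (ZP.+-injective eq) (ℕP.+-identityʳ r₂)
%ℕ-unique {n} {r₁} {r₂} (+ suc k) r₁<n _    eq = ⊥-elim (ℕP.<⇒≱ r₁<n n≤r₁)
  where
  r₁≡ : r₁ ≡ r₂ ℕ.+ suc k ℕ.* n
  r₁≡ = ZP.+-injective (P.trans eq (P.cong (λ z → + r₂ Z.+ z) (P.sym (ZP.pos-* (suc k) n))))
  n≤r₁ : n ℕ.≤ r₁
  n≤r₁ = P.subst (n ℕ.≤_) (P.sym r₁≡) (ℕP.≤-trans (ℕP.m≤m+n n (k ℕ.* n)) (ℕP.m≤n+m _ r₂))
%ℕ-unique {n} {r₁} {r₂} -[1+ k ] r₁<n r₂<n eq =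
  P.sym (%ℕ-unique (+ suc k) r₂<n r₁<n (P.trans (isolate (+ r₂) (+ n) -[1+ k ]) (P.cong (λ z → z Z.+ Z.- -[1+ k ] Z.* + n) (P.sym eq))))
  where
  isolate : ∀ b n e → b ≡ (b Z.+ e Z.* n) Z.+ Z.- e Z.* n
  isolate = solve-∀

[a+c*n]%ℕn≡a%ℕn : ∀ (n : ℕ) .{{_ : NonZero n}} (a c : ℤ) → (a Z.+ c Z.* + n) Z.%ℕ n ≡ a Z.%ℕ n
[a+c*n]%ℕn≡a%ℕn n a c = %ℕ-unique q (n%ℕd<d b n) (n%ℕd<d a n) eq
  where
  b = a Z.+ c Z.* + n
  rearrange : ∀ rb qb ra qa c n → rb ≡ ra Z.+ (qa Z.+ c Z.- qb) Z.* n Z.+ ((rb Z.+ qb Z.* n) Z.- ((ra Z.+ qa Z.* n) Z.+ c Z.* n))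
  rearrange = solve-∀
  q = a Z./ℕ n Z.+ c Z.- b Z./ℕ n
  eq : + (b Z.%ℕ n) ≡ + (a Z.%ℕ n) Z.+ q Z.* + n
  eq = begin
    + (b Z.%ℕ n)
      ≡⟨ rearrange (+ (b Z.%ℕ n)) (b Z./ℕ n) (+ (a Z.%ℕ n)) (a Z./ℕ n) c (+ n) ⟩
    + (a Z.%ℕ n) Z.+ q Z.* + n Z.+ ((+ (b Z.%ℕ n) Z.+ b Z./ℕ n Z.* + n) Z.- ((+ (a Z.%ℕ n) Z.+ a Z./ℕ n Z.* + n) Z.+ c Z.* + n))
      ≡⟨ P.cong₂ (λ u v → + (a Z.%ℕ n) Z.+ q Z.* + n Z.+ (u Z.- (v Z.+ c Z.* + n))) (P.sym (a≡a%ℕn+[a/ℕn]*n b n)) (P.sym (a≡a%ℕn+[a/ℕn]*n a n)) ⟩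
    + (a Z.%ℕ n) Z.+ q Z.* + n Z.+ (b Z.- b)
      ≡⟨ P.cong (λ z → + (a Z.%ℕ n) Z.+ q Z.* + n Z.+ z) (ZP.+-inverseʳ b) ⟩
    + (a Z.%ℕ n) Z.+ q Z.* + n Z.+ 0ℤ
      ≡⟨ ZP.+-identityʳ _ ⟩
    + (a Z.%ℕ n) Z.+ q Z.* + n ∎
    where open P.≡-Reasoning

+[m∸n]≡+m-+n : ∀ m n → n ℕ.≤ m → + (m ∸ n) ≡ + m Z.- + n
+[m∸n]≡+m-+n m n n≤m = P.sym (P.trans (ZP.m-n≡m⊖n m n) (ZP.⊖-≥ n≤m))

module BigOperators {c ℓ : Level} (R : CommutativeRing c ℓ) (n : ℕ) .{{_ : NonZero n}}
                    (x : ℕ → Fin n → CommutativeRing.Carrier R) where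
  open CommutativeRing R
  open Loop R n x
  open import Relation.Binary.Reasoning.Setoid setoid

  sumN-cong-< : ∀ l {f g : ℕ → Carrier} → (∀ u → u ℕ.< l → f u ≈ g u) → sumN l f ≈ sumN l g
  sumN-cong-< zero    f≈g = refl
  sumN-cong-< (suc l) f≈g = +-cong (f≈g 0 (s≤s z≤n)) (sumN-cong-< l (λ u u<l → f≈g (suc u) (s≤s u<l)))

  prodN-cong-< : ∀ l {f g : ℕ → Carrier} → (∀ u → u ℕ.< l → f u ≈ g u) → prodN l f ≈ prodN l g
  prodN-cong-< zero    f≈g = refl
  prodN-cong-< (suc l) f≈g = *-cong (f≈g 0 (s≤s z≤n)) (prodN-cong-< l (λ u u<l → f≈g (suc u) (s≤s u<l)))

  sumN-cong : ∀ l {f g : ℕ → Carrier} → (∀ u → f u ≈ g u) → sumN l f ≈ sumN l g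
  sumN-cong l f≈g = sumN-cong-< l (λ u _ → f≈g u)

  prodN-cong : ∀ l {f g : ℕ → Carrier} → (∀ u → f u ≈ g u) → prodN l f ≈ prodN l g
  prodN-cong l f≈g = prodN-cong-< l (λ u _ → f≈g u)

  sumN-+ : ∀ a b (f : ℕ → Carrier) → sumN (a ℕ.+ b) f ≈ sumN a f + sumN b (λ u → f (a ℕ.+ u))
  sumN-+ zero    b f = sym (+-identityˡ _)
  sumN-+ (suc a) b f = trans (+-congˡ (sumN-+ a b (f ∘ suc))) (sym (+-assoc _ _ _))

  prodN-+ : ∀ a b (f : ℕ → Carrier) → prodN (a ℕ.+ b) f ≈ prodN a f * prodN b (λ u → f (a ℕ.+ u))
  prodN-+ zero    b f = sym (*-identityˡ _)
  prodN-+ (suc a) b f = trans (*-congˡ (prodN-+ a b (f ∘ suc))) (sym (*-assoc _ _ _))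

  sumN-snoc : ∀ l (f : ℕ → Carrier) → sumN (suc l) f ≈ sumN l f + f l
  sumN-snoc zero    f = +-comm _ _
  sumN-snoc (suc l) f = trans (+-congˡ (sumN-snoc l (f ∘ suc))) (sym (+-assoc _ _ _))

  prodN-snoc : ∀ l (f : ℕ → Carrier) → prodN (suc l) f ≈ prodN l f * f l
  prodN-snoc zero    f = *-comm _ _
  prodN-snoc (suc l) f = trans (*-congˡ (prodN-snoc l (f ∘ suc))) (sym (*-assoc _ _ _))

  *-distribˡ-sumN : ∀ l a (f : ℕ → Carrier) → a * sumN l f ≈ sumN l (λ u → a * f u)
  *-distribˡ-sumN zero    a f = zeroʳ a
  *-distribˡ-sumN (suc l) a f = trans (distribˡ _ _ _) (+-congˡ (*-distribˡ-sumN l a (f ∘ suc)))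

  *-distribʳ-sumN : ∀ l a (f : ℕ → Carrier) → sumN l f * a ≈ sumN l (λ u → f u * a)
  *-distribʳ-sumN zero    a f = zeroˡ a
  *-distribʳ-sumN (suc l) a f = trans (distribʳ _ _ _) (+-congˡ (*-distribʳ-sumN l a (f ∘ suc)))

  sumN-zero : ∀ l (f : ℕ → Carrier) → (∀ u → u ℕ.< l → f u ≈ 0#) → sumN l f ≈ 0#
  sumN-zero zero    f f≈0 = refl
  sumN-zero (suc l) f f≈0 =
    trans (+-cong (f≈0 0 (s≤s z≤n)) (sumN-zero l (f ∘ suc) (λ u u<l → f≈0 (suc u) (s≤s u<l)))) (+-identityˡ _)

  sumN-last : ∀ l (f : ℕ → Carrier) → (∀ u → u ℕ.< l → f u ≈ 0#) → sumN (suc l) f ≈ f l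
  sumN-last l f f≈0 = trans (sumN-snoc l f) (trans (+-congʳ (sumN-zero l f f≈0)) (+-identityˡ _))

  sumN-reverse : ∀ l (f : ℕ → Carrier) → sumN l f ≈ sumN l (λ u → f (l ∸ suc u))
  sumN-reverse zero    f = refl
  sumN-reverse (suc l) f = trans (sumN-snoc l f) (trans (+-comm _ _) (+-congˡ (sumN-reverse l f)))

  sumN-+-distrib : ∀ l (f g : ℕ → Carrier) → sumN l (λ u → f u + g u) ≈ sumN l f + sumN l g
  sumN-+-distrib zero    f g = sym (+-identityˡ _)
  sumN-+-distrib (suc l) f g = begin
    (f 0 + g 0) + sumN l (λ u → f (suc u) + g (suc u)) ≈⟨ +-congˡ (sumN-+-distrib l (f ∘ suc) (g ∘ suc)) ⟩
    (f 0 + g 0) + (sumN l (f ∘ suc) + sumN l (g ∘ suc)) ≈⟨ +-assoc _ _ _ ⟩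
    f 0 + (g 0 + (sumN l (f ∘ suc) + sumN l (g ∘ suc))) ≈⟨ +-congˡ (x+[y+z]≈y+[x+z] _ _ _) ⟩
    f 0 + (sumN l (f ∘ suc) + (g 0 + sumN l (g ∘ suc))) ≈⟨ sym (+-assoc _ _ _) ⟩
    (f 0 + sumN l (f ∘ suc)) + (g 0 + sumN l (g ∘ suc)) ∎
    where
    x+[y+z]≈y+[x+z] : ∀ a b d → a + (b + d) ≈ b + (a + d)
    x+[y+z]≈y+[x+z] a b d = trans (sym (+-assoc _ _ _)) (trans (+-congʳ (+-comm a b)) (+-assoc _ _ _))

  sumN-comm : ∀ l l′ (F : ℕ → ℕ → Carrier) →
    sumN l (λ a → sumN l′ (F a)) ≈ sumN l′ (λ b → sumN l (λ a → F a b))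
  sumN-comm zero    l′ F = sym (sumN-zero l′ _ (λ _ _ → refl))
  sumN-comm (suc l) l′ F =
    trans (+-congˡ (sumN-comm l l′ (F ∘ suc))) (sym (sumN-+-distrib l′ (F 0) (λ b → sumN l (λ a → F (suc a) b))))

  cap : ℕ → ℕ → Carrier → Carrier
  cap m a z with a ℕ.≤? m
  ... | yes _ = z
  ... | no  _ = 0#

  cap-≤ : ∀ {m a} z → a ℕ.≤ m → cap m a z ≈ z
  cap-≤ {m} {a} z a≤m with a ℕ.≤? m
  ... | yes _  = refl
  ... | no a≰m = ⊥-elim (a≰m a≤m)

  cap-≰ : ∀ {m a} z → ¬ (a ℕ.≤ m) → cap m a z ≈ 0#
  cap-≰ {m} {a} z a≰m with a ℕ.≤? m
  ... | yes a≤m = ⊥-elim (a≰m a≤m)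
  ... | no _    = refl

  cap-*ˡ : ∀ m a z w → z * cap m a w ≈ cap m a (z * w)
  cap-*ˡ m a z w with a ℕ.≤? m
  ... | yes _ = refl
  ... | no  _ = zeroʳ z

  cap-*ʳ : ∀ m a z w → cap m a z * w ≈ cap m a (z * w)
  cap-*ʳ m a z w with a ℕ.≤? m
  ... | yes _ = refl
  ... | no  _ = zeroˡ w

  sumN-cap : ∀ m k (f : ℕ → Carrier) → m ℕ.≤ k → sumN (suc m) f ≈ sumN (suc k) (λ b → cap m b (f b))
  sumN-cap m k f m≤k = begin
    sumN (suc m) f                                          ≈⟨ sym (+-identityʳ _) ⟩
    sumN (suc m) f + 0#                                     ≈⟨ +-cong (sumN-cong-< (suc m) (λ u u≤m → sym (cap-≤ (f u) (ℕP.≤-pred u≤m))))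
                                                                      (sym (sumN-zero (k ∸ m) _ (λ u _ → cap-≰ _ (ℕP.<⇒≱ (ℕP.m≤m+n (suc m) u))))) ⟩
    sumN (suc m) g + sumN (k ∸ m) (λ u → g (suc m ℕ.+ u))   ≈⟨ sym (sumN-+ (suc m) (k ∸ m) g) ⟩
    sumN (suc m ℕ.+ (k ∸ m)) g                              ≡⟨ P.cong (λ z → sumN (suc z) g) (ℕP.m+[n∸m]≡n m≤k) ⟩
    sumN (suc k) g                                          ∎
    where g = λ b → cap m b (f b)

  sumN-⊓ : ∀ k m (f : ℕ → Carrier) → sumN (suc (k ⊓ m)) f ≈ sumN (suc k) (λ b → cap m b (f b))
  sumN-⊓ k m f with k ℕ.≤? m
  ... | yes k≤m = begin
      sumN (suc (k ⊓ m)) f ≡⟨ P.cong (λ z → sumN (suc z) f) (ℕP.m≤n⇒m⊓n≡m k≤m) ⟩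
      sumN (suc k) f       ≈⟨ sumN-cong-< (suc k) (λ u u≤k → sym (cap-≤ (f u) (ℕP.≤-trans (ℕP.≤-pred u≤k) k≤m))) ⟩
      sumN (suc k) (λ b → cap m b (f b)) ∎
  ... | no k≰m = begin
      sumN (suc (k ⊓ m)) f ≡⟨ P.cong (λ z → sumN (suc z) f) (ℕP.m≥n⇒m⊓n≡n m≤k) ⟩
      sumN (suc m) f       ≈⟨ sumN-cap m k f m≤k ⟩
      sumN (suc k) (λ b → cap m b (f b)) ∎
    where m≤k = ℕP.<⇒≤ (ℕP.≰⇒> k≰m)

  sumN-triangle-comm : ∀ k (F : ℕ → ℕ → Carrier) →
    sumN (suc k) (λ a → sumN (suc (k ∸ a)) (F a)) ≈ sumN (suc k) (λ b → sumN (suc (k ∸ b)) (λ a → F a b))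
  sumN-triangle-comm k F = begin
    sumN (suc k) (λ a → sumN (suc (k ∸ a)) (F a))
      ≈⟨ sumN-cong (suc k) (λ a → sumN-cap (k ∸ a) k (F a) (ℕP.m∸n≤m k a)) ⟩
    sumN (suc k) (λ a → sumN (suc k) (λ b → cap (k ∸ a) b (F a b)))
      ≈⟨ sumN-comm (suc k) (suc k) (λ a b → cap (k ∸ a) b (F a b)) ⟩
    sumN (suc k) (λ b → sumN (suc k) (λ a → cap (k ∸ a) b (F a b)))
      ≈⟨ sumN-cong-< (suc k) (λ b b≤k → sumN-cong-< (suc k) (λ a a≤k → cap-swap a b (ℕP.≤-pred a≤k) (ℕP.≤-pred b≤k))) ⟩
    sumN (suc k) (λ b → sumN (suc k) (λ a → cap (k ∸ b) a (F a b)))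
      ≈⟨ sym (sumN-cong (suc k) (λ b → sumN-cap (k ∸ b) k (λ a → F a b) (ℕP.m∸n≤m k b))) ⟩
    sumN (suc k) (λ b → sumN (suc (k ∸ b)) (λ a → F a b)) ∎
    where
    ≤∸-swap : ∀ a b → a ℕ.≤ k → b ℕ.≤ k ∸ a → a ℕ.≤ k ∸ b
    ≤∸-swap a b a≤k b≤k∸a = ℕP.m+n≤o⇒m≤o∸n a (P.subst (ℕ._≤ k) (ℕP.+-comm b a)
      (P.subst (b ℕ.+ a ℕ.≤_) (ℕP.m∸n+n≡m a≤k) (ℕP.+-monoˡ-≤ a b≤k∸a)))
    cap-swap : ∀ a b → a ℕ.≤ k → b ℕ.≤ k → cap (k ∸ a) b (F a b) ≈ cap (k ∸ b) a (F a b)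
    cap-swap a b a≤k b≤k with b ℕ.≤? k ∸ a | a ℕ.≤? k ∸ b
    ... | yes _ | yes _ = refl
    ... | no  _ | no  _ = refl
    ... | yes p | no ¬q = ⊥-elim (¬q (≤∸-swap a b a≤k p))
    ... | no ¬p | yes q = ⊥-elim (¬p (≤∸-swap b a b≤k q))

  reindex : ∀ {A : Set} (f : A → Carrier) {a b} → a ≡ b → f a ≈ f b
  reindex f a≡b = reflexive (P.cong f a≡b)

  fall-+ : ∀ (v : VecZ) u t a → fall v u (t ℕ.+ a) ≈ fall v u t * fall v (u Z.- + t) a
  fall-+ v u t a = trans (prodN-+ t a _) (*-congˡ (prodN-cong a (λ s → reindex v (assoc u (+ t) (+ s)))))
    where
    assoc : ∀ u t s → u Z.- (t Z.+ s) ≡ (u Z.- t) Z.- s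
    assoc = solve-∀

  fall-one : ∀ (v : VecZ) u → fall v u 1 ≈ v u
  fall-one v u = trans (*-identityʳ _) (reindex v (ZP.+-identityʳ u))

  fall-suc : ∀ (v : VecZ) u t → fall v u (suc t) ≈ v u * fall v (u Z.- 1ℤ) t
  fall-suc v u t = trans (fall-+ v u 1 t) (*-congʳ (fall-one v u))

  fall-snoc : ∀ (v : VecZ) u t → fall v u (suc t) ≈ fall v u t * v (u Z.- + t)
  fall-snoc v u t = prodN-snoc t (λ s → v (u Z.- + s))

  prodN-ascending : ∀ (v : VecZ) l a → prodN l (λ u → v (a Z.+ + u Z.+ 1ℤ)) ≈ fall v (a Z.+ + l) l
  prodN-ascending v zero    a = refl
  prodN-ascending v (suc l) a = begin
    prodN (suc l) (λ u → v (a Z.+ + u Z.+ 1ℤ))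
      ≈⟨ prodN-snoc l _ ⟩
    prodN l (λ u → v (a Z.+ + u Z.+ 1ℤ)) * v (a Z.+ + l Z.+ 1ℤ)
      ≈⟨ *-cong (prodN-ascending v l a) (reindex v top) ⟩
    fall v (a Z.+ + l) l * v (a Z.+ + suc l)
      ≈⟨ *-comm _ _ ⟩
    v (a Z.+ + suc l) * fall v (a Z.+ + l) l
      ≈⟨ sym (trans (fall-suc v (a Z.+ + suc l) l) (*-congˡ (reindex (λ z → fall v z l) lower))) ⟩
    fall v (a Z.+ + suc l) (suc l) ∎
    where
    top : a Z.+ + l Z.+ 1ℤ ≡ a Z.+ + suc l
    top = P.trans (ZP.+-assoc a (+ l) 1ℤ) (P.cong (λ z → a Z.+ z) (ZP.+-comm (+ l) 1ℤ))
    lower : a Z.+ + suc l Z.- 1ℤ ≡ a Z.+ + l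
    lower = P.trans (P.cong (λ z → z Z.- 1ℤ) (P.sym top)) (cancel (a Z.+ + l))
      where
      cancel : ∀ a → a Z.+ 1ℤ Z.- 1ℤ ≡ a
      cancel = solve-∀

module Periodicity {c ℓ : Level} (R : CommutativeRing c ℓ) (n′ : ℕ)
                   (x : ℕ → Fin (suc n′) → CommutativeRing.Carrier R) where
  open CommutativeRing R
  open Loop R (suc n′) x
  open BigOperators R (suc n′) x

  n : ℕ
  n = suc n′

  Periodic : VecZ → Set ℓ
  Periodic v = ∀ a k → v (a Z.+ k Z.* + n) ≈ v a

  X-periodic : ∀ i → Periodic (X i)
  X-periodic i a k = reflexive (P.cong (x i) (fromℕ<-cong _ _ ([a+c*n]%ℕn≡a%ℕn n a k) _ _))

  private
    shift-out : ∀ a k n s → (a Z.+ k Z.* n) Z.- s ≡ (a Z.- s) Z.+ k Z.* n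
    shift-out = solve-∀

  fall-periodic : ∀ {v} → Periodic v → ∀ l a k → fall v (a Z.+ k Z.* + n) l ≈ fall v a l
  fall-periodic {v} v-per l a k = prodN-cong l (λ s → trans (reindex v (shift-out a k (+ n) (+ s))) (v-per (a Z.- + s) k))

  summand-periodic : ∀ i is d b a k →
    fall (X i) (a Z.+ k Z.* + n) b * τ (map X is) (d ∸ b) ((a Z.+ k Z.* + n) Z.- + b) ≈ fall (X i) a b * τ (map X is) (d ∸ b) (a Z.- + b)
  τ-periodic : ∀ (is : List ℕ) d a k → τ (map X is) d (a Z.+ k Z.* + n) ≈ τ (map X is) d a

  summand-periodic i is d b a k =
    *-cong (fall-periodic (X-periodic i) b a k)
           (trans (reindex (τ (map X is) (d ∸ b)) (shift-out a k (+ n) (+ b))) (τ-periodic is (d ∸ b) (a Z.- + b) k))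

  τ-periodic []       zero    a k = refl
  τ-periodic []       (suc d) a k = refl
  τ-periodic (i ∷ is) d       a k = sumN-cong (suc (d ⊓ n′)) (λ b → summand-periodic i is d b a k)

  σ-periodic : ∀ i (is : List ℕ) d → Periodic (σ (X i) (map X is) d)
  σ-periodic i is d a k = sumN-cong (suc d) (λ b → summand-periodic i is d b a k)

  fall-period-step : ∀ {v} → Periodic v → ∀ a → fall v (a Z.+ 1ℤ) n ≈ fall v a n
  fall-period-step {v} v-per a = begin
    fall v (a Z.+ 1ℤ) (suc n′)                 ≈⟨ fall-suc v (a Z.+ 1ℤ) n′ ⟩
    v (a Z.+ 1ℤ) * fall v (a Z.+ 1ℤ Z.- 1ℤ) n′ ≈⟨ *-cong (sym (trans (reindex v (wrap a (+ n′))) (v-per (a Z.+ 1ℤ) Z.-1ℤ)))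
                                                          (reindex (λ z → fall v z n′) (cancel a)) ⟩
    v (a Z.- + n′) * fall v a n′               ≈⟨ *-comm _ _ ⟩
    fall v a n′ * v (a Z.- + n′)               ≈⟨ sym (fall-snoc v a n′) ⟩
    fall v a (suc n′)                          ∎
    where
    open import Relation.Binary.Reasoning.Setoid setoid
    cancel : ∀ a → a Z.+ 1ℤ Z.- 1ℤ ≡ a
    cancel = solve-∀
    wrap : ∀ a m → a Z.- m ≡ (a Z.+ 1ℤ) Z.+ Z.-1ℤ Z.* (1ℤ Z.+ m)
    wrap = solve-∀

  fall-period-+ℕ : ∀ {v} → Periodic v → ∀ a c → fall v (a Z.+ + c) n ≈ fall v a n
  fall-period-+ℕ {v} v-per a zero    = reindex (λ z → fall v z n) (ZP.+-identityʳ a)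
  fall-period-+ℕ {v} v-per a (suc c) =
    trans (reindex (λ z → fall v z n) (step a (+ c))) (trans (fall-period-step v-per (a Z.+ + c)) (fall-period-+ℕ v-per a c))
    where
    step : ∀ a c → a Z.+ (1ℤ Z.+ c) ≡ a Z.+ c Z.+ 1ℤ
    step = solve-∀

  fall-period-invariant : ∀ {v} → Periodic v → ∀ a → fall v a n ≈ fall v 0ℤ n
  fall-period-invariant {v} v-per (+ c)    =
    trans (reindex (λ z → fall v z n) (P.sym (ZP.+-identityˡ (+ c)))) (fall-period-+ℕ v-per 0ℤ c)
  fall-period-invariant {v} v-per -[1+ c ] =
    sym (trans (reindex (λ z → fall v z n) (P.sym (ZP.+-inverseˡ (+ suc c)))) (fall-period-+ℕ v-per -[1+ c ] (suc c)))

module LastVector {c ℓ : Level} (R : CommutativeRing c ℓ) (n′ : ℕ)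
                  (x : ℕ → Fin (suc n′) → CommutativeRing.Carrier R) where
  open CommutativeRing R
  open Loop R (suc n′) x
  open BigOperators R (suc n′) x
  open Periodicity R n′ x
  open import Relation.Binary.Reasoning.Setoid setoid

  -- σ v ws is conv (fall v) (τ ws) by definition, and τ (w ∷ ws) is conv (block w) (τ ws)
  -- once the multiplicity bound n - 1 is moved into block.
  conv : (ℤ → ℕ → Carrier) → (ℕ → ℤ → Carrier) → ℕ → ℤ → Carrier
  conv g h k u = sumN (suc k) (λ a → g u a * h (k ∸ a) (u Z.- + a))

  rconv : (ℕ → ℤ → Carrier) → (ℤ → ℕ → Carrier) → ℕ → ℤ → Carrier
  rconv h W k u = sumN (suc k) (λ b → h (k ∸ b) u * W (u Z.- + (k ∸ b)) b)

  rconv-congˡ : ∀ {h h′} W → (∀ k u → h k u ≈ h′ k u) → ∀ k u → rconv h W k u ≈ rconv h′ W k u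
  rconv-congˡ {h} {h′} W h≈h′ k u =
    sumN-cong (suc k) {λ b → h (k ∸ b) u * W (u Z.- + (k ∸ b)) b} {λ b → h′ (k ∸ b) u * W (u Z.- + (k ∸ b)) b}
      (λ b → *-congʳ (h≈h′ (k ∸ b) u))

  conv-rconv-assoc : ∀ g h H W → (∀ k u → H k u ≈ rconv h W k u) →
                     ∀ k u → conv g H k u ≈ rconv (conv g h) W k u
  conv-rconv-assoc g h H W H≈ k u = begin
    conv g H k u
      ≈⟨ sumN-cong (suc k) (λ a → trans (*-congˡ (H≈ (k ∸ a) (u Z.- + a))) (*-distribˡ-sumN (suc (k ∸ a)) (g u a) (inner a))) ⟩
    sumN (suc k) (λ a → sumN (suc (k ∸ a)) (F a))
      ≈⟨ sumN-triangle-comm k F ⟩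
    sumN (suc k) (λ b → sumN (suc (k ∸ b)) (λ a → F a b))
      ≈⟨ sumN-cong-< (suc k) (λ b b≤k →
           trans (sumN-cong-< (suc (k ∸ b)) (λ a a≤k∸b → regroup b a (ℕP.≤-pred a≤k∸b)))
                 (sym (*-distribʳ-sumN (suc (k ∸ b)) (W (u Z.- + (k ∸ b)) b) (λ a → g u a * h (k ∸ b ∸ a) (u Z.- + a))))) ⟩
    rconv (conv g h) W k u ∎
    where
    inner : ℕ → ℕ → Carrier
    inner a b = h (k ∸ a ∸ b) (u Z.- + a) * W ((u Z.- + a) Z.- + (k ∸ a ∸ b)) b
    F : ℕ → ℕ → Carrier
    F a b = g u a * inner a b
    ∸-comm : ∀ a b → k ∸ a ∸ b ≡ k ∸ b ∸ a
    ∸-comm a b = P.trans (ℕP.∸-+-assoc k a b) (P.trans (P.cong (k ∸_) (ℕP.+-comm a b)) (P.sym (ℕP.∸-+-assoc k b a)))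
    cancel : ∀ u a m → (u Z.- a) Z.- (m Z.- a) ≡ u Z.- m
    cancel = solve-∀
    regroup : ∀ b a → a ℕ.≤ k ∸ b → F a b ≈ (g u a * h (k ∸ b ∸ a) (u Z.- + a)) * W (u Z.- + (k ∸ b)) b
    regroup b a a≤k∸b = begin
      F a b ≈⟨ *-congˡ (*-cong (reindex (λ z → h z (u Z.- + a)) (∸-comm a b)) (reindex (λ z → W z b) index)) ⟩
      g u a * (h (k ∸ b ∸ a) (u Z.- + a) * W (u Z.- + (k ∸ b)) b) ≈⟨ sym (*-assoc _ _ _) ⟩
      (g u a * h (k ∸ b ∸ a) (u Z.- + a)) * W (u Z.- + (k ∸ b)) b ∎
      where
      index : (u Z.- + a) Z.- + (k ∸ a ∸ b) ≡ u Z.- + (k ∸ b)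
      index = P.trans (P.cong (λ z → (u Z.- + a) Z.- z) (P.trans (P.cong +_ (∸-comm a b)) (+[m∸n]≡+m-+n (k ∸ b) a a≤k∸b)))
                      (cancel u (+ a) (+ (k ∸ b)))

  block : VecZ → ℤ → ℕ → Carrier
  block w u b = cap n′ b (fall w u b)

  τ-∷ : ∀ w ws k u → τ (w ∷ ws) k u ≈ conv (block w) (τ ws) k u
  τ-∷ w ws k u = trans (sumN-⊓ k n′ term) (sumN-cong (suc k) (λ a → sym (cap-*ʳ n′ a (fall w u a) (τ ws (k ∸ a) (u Z.- + a)))))
    where
    term = λ a → fall w u a * τ ws (k ∸ a) (u Z.- + a)

  τ-zero : ∀ ws u → τ ws 0 u ≈ 1#
  τ-zero []       u = refl
  τ-zero (w ∷ ws) u = trans (+-identityʳ _) (trans (*-identityˡ _) (τ-zero ws _))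

  τ[]-pos : ∀ d u → 0 ℕ.< d → τ [] d u ≈ 0#
  τ[]-pos (suc d) u _ = refl

  τ-∷ʳ : ∀ ws w k u → τ (ws ++ w ∷ []) k u ≈ rconv (τ ws) (block w) k u
  τ-∷ʳ []        w k u = begin
    τ (w ∷ []) k u                ≈⟨ τ-∷ w [] k u ⟩
    conv (block w) (τ []) k u     ≈⟨ sumN-last k (λ a → block w u a * τ [] (k ∸ a) (u Z.- + a)) (λ a a<k → trans (*-congˡ (τ[]-pos (k ∸ a) (u Z.- + a) (ℕP.m<n⇒0<n∸m a<k))) (zeroʳ _)) ⟩
    block w u k * τ [] (k ∸ k) (u Z.- + k) ≡⟨ P.cong (λ d → block w u k * τ [] d (u Z.- + k)) (ℕP.n∸n≡0 k) ⟩
    block w u k * 1#              ≈⟨ trans (*-identityʳ _) (sym (*-identityˡ _)) ⟩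
    1# * block w u k              ≡⟨ P.cong (λ z → 1# * block w z k) (P.sym (ZP.+-identityʳ u)) ⟩
    1# * block w (u Z.- + 0) k    ≡⟨ P.cong (λ d → τ [] d u * block w (u Z.- + d) k) (P.sym (ℕP.n∸n≡0 k)) ⟩
    τ [] (k ∸ k) u * block w (u Z.- + (k ∸ k)) k
                                  ≈⟨ sym (sumN-last k (λ b → τ [] (k ∸ b) u * block w (u Z.- + (k ∸ b)) b) (λ b b<k → trans (*-congʳ (τ[]-pos (k ∸ b) u (ℕP.m<n⇒0<n∸m b<k))) (zeroˡ _))) ⟩
    rconv (τ []) (block w) k u    ∎
  τ-∷ʳ (w′ ∷ ws) w k u = begin
    τ (w′ ∷ ws ++ w ∷ []) k u                  ≈⟨ τ-∷ w′ (ws ++ w ∷ []) k u ⟩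
    conv (block w′) (τ (ws ++ w ∷ [])) k u     ≈⟨ conv-rconv-assoc (block w′) (τ ws) (τ (ws ++ w ∷ [])) (block w) (τ-∷ʳ ws w) k u ⟩
    rconv (conv (block w′) (τ ws)) (block w) k u ≈⟨ rconv-congˡ (block w) (λ d u → sym (τ-∷ w′ ws d u)) k u ⟩
    rconv (τ (w′ ∷ ws)) (block w) k u          ∎

  σ-∷ʳ : ∀ v ws w k u → σ v (ws ++ w ∷ []) k u ≈ rconv (σ v ws) (block w) k u
  σ-∷ʳ v ws w = conv-rconv-assoc (fall v) (τ ws) _ (block w) (τ-∷ʳ ws w)

  τ-vanishes : ∀ ws d u → n′ ℕ.* length ws ℕ.< d → τ ws d u ≈ 0#
  τ-vanishes []       (suc d) u _ = refl
  τ-vanishes (w ∷ ws) d       u top<d = sumN-zero (suc (d ⊓ n′)) (λ a → fall w u a * τ ws (d ∸ a) (u Z.- + a)) (λ a a≤d⊓n′ →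
    trans (*-congˡ (τ-vanishes ws (d ∸ a) (u Z.- + a) (top<d∸a a (ℕP.≤-trans (ℕP.≤-pred a≤d⊓n′) (ℕP.m⊓n≤n d n′))))) (zeroʳ _))
    where
    top<d∸a : ∀ a → a ℕ.≤ n′ → n′ ℕ.* length ws ℕ.< d ∸ a
    top<d∸a a a≤n′ = ℕP.<-≤-trans (ℕP.m+n≤o⇒m≤o∸n (suc (n′ ℕ.* length ws))
        (P.subst (ℕ._≤ d) (P.cong suc (P.trans (ℕP.*-suc n′ (length ws)) (ℕP.+-comm n′ _))) top<d)) (ℕP.∸-monoʳ-≤ d a≤n′)

  σ-above-top : ∀ v ws t u →
    σ v ws (t ℕ.+ n′ ℕ.* length ws) u ≈ fall v u t * σ v ws (n′ ℕ.* length ws) (u Z.- + t)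
  σ-above-top v ws t u = begin
    sumN (suc (t ℕ.+ N)) f                                  ≡⟨ P.cong (λ l → sumN l f) (P.sym (ℕP.+-suc t N)) ⟩
    sumN (t ℕ.+ suc N) f                                    ≈⟨ sumN-+ t (suc N) f ⟩
    sumN t f + sumN (suc N) (λ a → f (t ℕ.+ a))             ≈⟨ +-congʳ (sumN-zero t f (λ a a<t →
                                                                 trans (*-congˡ (τ-vanishes ws _ _ (N<t+N∸a a a<t))) (zeroʳ _))) ⟩
    0# + sumN (suc N) (λ a → f (t ℕ.+ a))                   ≈⟨ +-identityˡ _ ⟩
    sumN (suc N) (λ a → f (t ℕ.+ a))                        ≈⟨ sumN-cong (suc N) split ⟩
    sumN (suc N) (λ a → fall v u t * g a)                   ≈⟨ sym (*-distribˡ-sumN (suc N) (fall v u t) g) ⟩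
    fall v u t * σ v ws N (u Z.- + t)                       ∎
    where
    N = n′ ℕ.* length ws
    f = λ a → fall v u a * τ ws (t ℕ.+ N ∸ a) (u Z.- + a)
    g = λ a → fall v (u Z.- + t) a * τ ws (N ∸ a) ((u Z.- + t) Z.- + a)
    N<t+N∸a : ∀ a → a ℕ.< t → N ℕ.< t ℕ.+ N ∸ a
    N<t+N∸a a a<t = P.subst (N ℕ.<_) (P.sym (ℕP.+-∸-comm N (ℕP.<⇒≤ a<t))) (ℕP.+-monoˡ-≤ N (ℕP.m<n⇒0<n∸m a<t))
    assoc : ∀ u t a → u Z.- (t Z.+ a) ≡ (u Z.- t) Z.- a
    assoc = solve-∀
    split : ∀ a → f (t ℕ.+ a) ≈ fall v u t * g a
    split a = trans (*-cong (fall-+ v u t a)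
                            (reflexive (P.cong₂ (τ ws) (ℕP.[m+n]∸[m+o]≡n∸o t N a)
                                                       (assoc u (+ t) (+ a)))))
                    (*-assoc _ _ _)

  σ-top-∷ʳ : ∀ v ws w → Periodic w → ∀ u →
    σ v (ws ++ w ∷ []) (n′ ℕ.* suc (length ws)) u ≈
    sumN (suc n′) (λ t → fall v u t * σ v ws (n′ ℕ.* length ws) (u Z.- + t)
                         * prodN (n′ ∸ t) (λ s → w (u Z.- + t Z.+ + length ws Z.- + s)))
  σ-top-∷ʳ v ws w w-per u = begin
    σ v (ws ++ w ∷ []) N₁ u                              ≈⟨ σ-∷ʳ v ws w N₁ u ⟩
    rconv (σ v ws) (block w) N₁ u                        ≈⟨ sumN-cong (suc N₁) (λ b → cap-*ˡ n′ b (σ v ws (N₁ ∸ b) u) (fall w (u Z.- + (N₁ ∸ b)) b)) ⟩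
    sumN (suc N₁) (λ b → cap n′ b (f b))                 ≈⟨ sym (sumN-cap n′ N₁ f n′≤N₁) ⟩
    sumN (suc n′) f                                      ≈⟨ sumN-reverse (suc n′) f ⟩
    sumN (suc n′) (λ t → f (n′ ∸ t))                     ≈⟨ sumN-cong-< (suc n′) (λ t t≤n′ → term t (ℕP.≤-pred t≤n′)) ⟩
    sumN (suc n′) (λ t → fall v u t * σ v ws N (u Z.- + t) * prodN (n′ ∸ t) (λ s → w (u Z.- + t Z.+ + L Z.- + s))) ∎
    where
    L  = length ws
    N  = n′ ℕ.* L
    N₁ = n′ ℕ.* suc L
    f : ℕ → Carrier
    f b = σ v ws (N₁ ∸ b) u * fall w (u Z.- + (N₁ ∸ b)) b
    N₁≡ : N₁ ≡ n′ ℕ.+ N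
    N₁≡ = ℕP.*-suc n′ L
    n′≤N₁ : n′ ℕ.≤ N₁
    n′≤N₁ = P.subst (n′ ℕ.≤_) (P.sym N₁≡) (ℕP.m≤m+n n′ N)
    degree : ∀ t → t ℕ.≤ n′ → N₁ ∸ (n′ ∸ t) ≡ t ℕ.+ N
    degree t t≤n′ = P.trans (P.cong (_∸ (n′ ∸ t)) N₁≡) (P.trans (ℕP.+-∸-comm N (ℕP.m∸n≤m n′ t)) (P.cong (ℕ._+ N) (ℕP.m∸[m∸n]≡n t≤n′)))
    wrap′ : ∀ u t L m → u Z.- (t Z.+ m Z.* L) ≡ (u Z.- t Z.+ L) Z.+ Z.- L Z.* (1ℤ Z.+ m)
    wrap′ = solve-∀
    wrap : ∀ t → u Z.- + (t ℕ.+ N) ≡ (u Z.- + t Z.+ + L) Z.+ Z.- + L Z.* + suc n′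
    wrap t = P.trans (P.cong (λ z → u Z.- (+ t Z.+ z)) (ZP.pos-* n′ L)) (wrap′ u (+ t) (+ L) (+ n′))
    term : ∀ t → t ℕ.≤ n′ → f (n′ ∸ t) ≈ fall v u t * σ v ws N (u Z.- + t) * prodN (n′ ∸ t) (λ s → w (u Z.- + t Z.+ + L Z.- + s))
    term t t≤n′ = begin
      σ v ws (N₁ ∸ (n′ ∸ t)) u * fall w (u Z.- + (N₁ ∸ (n′ ∸ t))) (n′ ∸ t)
        ≡⟨ P.cong (λ d → σ v ws d u * fall w (u Z.- + d) (n′ ∸ t)) (degree t t≤n′) ⟩
      σ v ws (t ℕ.+ N) u * fall w (u Z.- + (t ℕ.+ N)) (n′ ∸ t)
        ≈⟨ *-cong (σ-above-top v ws t u)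
                  (trans (reindex (λ z → fall w z (n′ ∸ t)) (wrap t)) (fall-periodic w-per (n′ ∸ t) (u Z.- + t Z.+ + L) (Z.- + L))) ⟩
      fall v u t * σ v ws N (u Z.- + t) * prodN (n′ ∸ t) (λ s → w (u Z.- + t Z.+ + L Z.- + s)) ∎

module PSum {c ℓ : Level} (R : CommutativeRing c ℓ) (m : ℕ)
            (xs : ℕ → Fin (suc (suc m)) → CommutativeRing.Carrier R)
            (x ρ y : Loop.VecZ R (suc (suc m)) xs) (d : ℕ) where
  open CommutativeRing R
  open Loop R (suc (suc m)) xs
  open BigOperators R (suc (suc m)) xs
  open import Relation.Binary.Reasoning.Setoid setoid

  Psum : ℕ → ℤ → Carrier
  Psum k q = sumN (suc k) (λ t → fall x q t * ρ (q Z.- + t) * fall y (q Z.- + t Z.+ + d) (k ∸ t))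

  Psum-zero : ∀ q → Psum 0 q ≈ ρ q
  Psum-zero q = trans (+-identityʳ _) (trans (*-identityʳ _) (trans (*-identityˡ _) (reindex ρ (ZP.+-identityʳ q))))

  Psum-split : ∀ k l q → k ℕ.≤ l →
    Psum (suc l) q ≈ fall y (q Z.+ + d Z.- + k) (suc l ∸ k) * Psum k q + fall x q (suc k) * Psum (l ∸ k) (q Z.- + suc k)
  Psum-split k l q k≤l = begin
    sumN (suc (suc l)) term                                   ≡⟨ P.cong (λ z → sumN z term) length≡ ⟩
    sumN (suc k ℕ.+ suc (l ∸ k)) term                         ≈⟨ sumN-+ (suc k) (suc (l ∸ k)) term ⟩
    sumN (suc k) term + sumN (suc (l ∸ k)) (λ u → term (suc k ℕ.+ u))
      ≈⟨ +-cong (trans (sumN-cong-< (suc k) low) (trans (sym (*-distribʳ-sumN (suc k) yblock head)) (*-comm _ _)))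
                (trans (sumN-cong (suc (l ∸ k)) high) (sym (*-distribˡ-sumN (suc (l ∸ k)) (fall x q (suc k)) tail))) ⟩
    yblock * Psum k q + fall x q (suc k) * Psum (l ∸ k) (q Z.- + suc k) ∎
    where
    term head : ℕ → Carrier
    term t = fall x q t * ρ (q Z.- + t) * fall y (q Z.- + t Z.+ + d) (suc l ∸ t)
    head t = fall x q t * ρ (q Z.- + t) * fall y (q Z.- + t Z.+ + d) (k ∸ t)
    q′ = q Z.- + suc k
    tail : ℕ → Carrier
    tail u = fall x q′ u * ρ (q′ Z.- + u) * fall y (q′ Z.- + u Z.+ + d) (l ∸ k ∸ u)
    yblock = fall y (q Z.+ + d Z.- + k) (suc l ∸ k)
    length≡ : suc (suc l) ≡ suc k ℕ.+ suc (l ∸ k)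
    length≡ = P.cong suc (P.trans (P.cong suc (P.sym (ℕP.m+[n∸m]≡n k≤l))) (P.sym (ℕP.+-suc k (l ∸ k))))
    top-index : ∀ q t d k → (q Z.- t Z.+ d) Z.- (k Z.- t) ≡ q Z.+ d Z.- k
    top-index = solve-∀
    low : ∀ t → t ℕ.< suc k → term t ≈ head t * yblock
    low t t≤k = begin
      term t
        ≡⟨ P.cong (λ z → fall x q t * ρ (q Z.- + t) * fall y (q Z.- + t Z.+ + d) z) split≡ ⟩
      fall x q t * ρ (q Z.- + t) * fall y (q Z.- + t Z.+ + d) ((k ∸ t) ℕ.+ (suc l ∸ k))
        ≈⟨ *-congˡ (fall-+ y (q Z.- + t Z.+ + d) (k ∸ t) (suc l ∸ k)) ⟩
      fall x q t * ρ (q Z.- + t) * (fall y (q Z.- + t Z.+ + d) (k ∸ t) * fall y ((q Z.- + t Z.+ + d) Z.- + (k ∸ t)) (suc l ∸ k))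
        ≈⟨ *-congˡ (*-congˡ (reindex (λ z → fall y z (suc l ∸ k))
             (P.trans (P.cong (λ z → (q Z.- + t Z.+ + d) Z.- z) (+[m∸n]≡+m-+n k t (ℕP.≤-pred t≤k))) (top-index q (+ t) (+ d) (+ k))))) ⟩
      fall x q t * ρ (q Z.- + t) * (fall y (q Z.- + t Z.+ + d) (k ∸ t) * yblock)
        ≈⟨ sym (*-assoc _ _ _) ⟩
      head t * yblock ∎
      where
      split≡ : suc l ∸ t ≡ (k ∸ t) ℕ.+ (suc l ∸ k)
      split≡ = P.trans (P.cong (_∸ t) (P.sym (ℕP.m+[n∸m]≡n (ℕP.≤-trans k≤l (ℕP.n≤1+n l))))) (ℕP.+-∸-comm (suc l ∸ k) (ℕP.≤-pred t≤k))
    assoc : ∀ q t u → q Z.- (t Z.+ u) ≡ (q Z.- t) Z.- u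
    assoc = solve-∀
    high : ∀ u → term (suc k ℕ.+ u) ≈ fall x q (suc k) * tail u
    high u = begin
      term (suc k ℕ.+ u)
        ≈⟨ *-cong (*-cong (fall-+ x q (suc k) u) (reindex ρ (assoc q (+ suc k) (+ u))))
                  (reflexive (P.cong₂ (fall y) (P.cong (λ z → z Z.+ + d) (assoc q (+ suc k) (+ u))) (P.sym (ℕP.∸-+-assoc l k u)))) ⟩
      fall x q (suc k) * fall x q′ u * ρ (q′ Z.- + u) * fall y (q′ Z.- + u Z.+ + d) (l ∸ k ∸ u)
        ≈⟨ trans (*-congʳ (*-assoc _ _ _)) (*-assoc _ _ _) ⟩
      fall x q (suc k) * tail u ∎

  Psum-suc : ∀ l q → Psum (suc l) q ≈ ρ q * fall y (q Z.+ + d) (suc l) + x q * Psum l (q Z.- 1ℤ)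
  Psum-suc l q = trans (Psum-split 0 l q z≤n)
    (+-cong (trans (*-comm _ _) (*-cong (Psum-zero q) (reindex (λ z → fall y z (suc l)) (ZP.+-identityʳ (q Z.+ + d)))))
            (*-cong (fall-one x q) refl))

  Psum-sucʳ : ∀ l q → Psum (suc l) q ≈ fall x q (suc l) * ρ (q Z.- + suc l) + y (q Z.+ + d Z.- + l) * Psum l q
  Psum-sucʳ l q = trans (Psum-split l l q ℕP.≤-refl)
    (trans (+-comm _ _)
      (+-cong (*-congˡ (trans (reflexive (P.cong (λ k → Psum k (q Z.- + suc l)) (ℕP.n∸n≡0 l))) (Psum-zero (q Z.- + suc l))))
              (*-congʳ (trans (reflexive (P.cong (fall y (q Z.+ + d Z.- + l)) (ℕP.m+n∸n≡m 1 l))) (fall-one y (q Z.+ + d Z.- + l))))))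

  open Periodicity R (suc m) xs using (Periodic; fall-period-invariant; n)
  open import Algebra.Solver.Ring.NaturalCoefficients.Default commutativeSemiring using (solve; _:=_; _:+_; _:*_)
  open import Algebra.Properties.Group +-group using (∙-cancelʳ)

  module WithPeriodicity (x-per : Periodic x) (ρ-per : Periodic ρ) (y-per : Periodic y) where

    Q : ℤ → Carrier
    Q = Psum (suc m)

    Ex Ey : Carrier
    Ex = fall x 0ℤ n
    Ey = fall y 0ℤ n

    exchange : ∀ p → x p * Q (p Z.- 1ℤ) + ρ p * Ey ≈ y (p Z.+ + d Z.+ 1ℤ) * Q p + ρ p * Ex
    exchange p = begin
      x p * Q (p Z.- 1ℤ) + ρ p * Ey             ≈⟨ +-cong (*-congˡ Q[p-1]) (*-congˡ Ey≈) ⟩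
      x p * (F * ρ p + y′ * A) + ρ p * (y′ * G) ≈⟨ solve 6 (λ xp F ρp y′ A G → xp :* (F :* ρp :+ y′ :* A) :+ ρp :* (y′ :* G)
                                                                  := y′ :* (ρp :* G :+ xp :* A) :+ ρp :* (xp :* F)) refl (x p) F (ρ p) y′ A G ⟩
      y′ * (ρ p * G + x p * A) + ρ p * (x p * F) ≈⟨ +-cong (*-congˡ (sym (Psum-suc m p))) (*-congˡ Ex≈) ⟩
      y′ * Q p + ρ p * Ex ∎
      where
      F = fall x (p Z.- 1ℤ) (suc m)
      A = Psum m (p Z.- 1ℤ)
      G = fall y (p Z.+ + d) (suc m)
      y′ = y (p Z.+ + d Z.+ 1ℤ)
      around₁ : ∀ p m → (p Z.- 1ℤ) Z.- (1ℤ Z.+ m) ≡ p Z.+ Z.-1ℤ Z.* (1ℤ Z.+ (1ℤ Z.+ m))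
      around₁ = solve-∀
      around₂ : ∀ p d m → (p Z.- 1ℤ) Z.+ d Z.- m ≡ (p Z.+ d Z.+ 1ℤ) Z.+ Z.-1ℤ Z.* (1ℤ Z.+ (1ℤ Z.+ m))
      around₂ = solve-∀
      down : ∀ p d → (p Z.+ d Z.+ 1ℤ) Z.- 1ℤ ≡ p Z.+ d
      down = solve-∀
      ρ≈ : ρ ((p Z.- 1ℤ) Z.- + suc m) ≈ ρ p
      ρ≈ = trans (reindex ρ (around₁ p (+ m)))
                 (ρ-per p Z.-1ℤ)
      y≈ : y ((p Z.- 1ℤ) Z.+ + d Z.- + m) ≈ y′
      y≈ = trans (reindex y (around₂ p (+ d) (+ m)))
                 (y-per (p Z.+ + d Z.+ 1ℤ) Z.-1ℤ)
      Q[p-1] : Q (p Z.- 1ℤ) ≈ F * ρ p + y′ * A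
      Q[p-1] = trans (Psum-sucʳ m (p Z.- 1ℤ)) (+-cong (*-congˡ ρ≈) (*-congʳ y≈))
      Ey≈ : Ey ≈ y′ * G
      Ey≈ = trans (sym (fall-period-invariant y-per (p Z.+ + d Z.+ 1ℤ)))
                  (trans (fall-suc y (p Z.+ + d Z.+ 1ℤ) (suc m)) (*-congˡ (reindex (λ z → fall y z (suc m)) (down p (+ d)))))
      Ex≈ : x p * F ≈ Ex
      Ex≈ = trans (sym (fall-suc x p (suc m))) (fall-period-invariant x-per p)

    -- Both sides differ by a multiple of Ey; adding it turns them into instances of the exchange identity.
    private
      recurrence-base : ∀ Q₁ Q₀ Q₂ xq x₁ ρq ρ₁ y′ yd →
        xq * Q₁ + ρq * Ey ≈ y′ * Q₀ + ρq * Ex →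
        x₁ * Q₂ + ρ₁ * Ey ≈ yd * Q₁ + ρ₁ * Ex →
        Q₁ * (xq * ρ₁ + yd * ρq) ≈ y′ * Q₀ * ρ₁ + Q₂ * ρq * x₁
      recurrence-base Q₁ Q₀ Q₂ xq x₁ ρq ρ₁ y′ yd e₀ e₁ = ∙-cancelʳ (ρ₁ * ρq * Ey) _ _ (begin
        Q₁ * (xq * ρ₁ + yd * ρq) + ρ₁ * ρq * Ey
          ≈⟨ solve 7 (λ Q₁ xq ρq ρ₁ yd Ex Ey → Q₁ :* (xq :* ρ₁ :+ yd :* ρq) :+ ρ₁ :* ρq :* Ey
                                              := ρ₁ :* (xq :* Q₁ :+ ρq :* Ey) :+ yd :* ρq :* Q₁) refl Q₁ xq ρq ρ₁ yd Ex Ey ⟩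
        ρ₁ * (xq * Q₁ + ρq * Ey) + yd * ρq * Q₁ ≈⟨ +-congʳ (*-congˡ e₀) ⟩
        ρ₁ * (y′ * Q₀ + ρq * Ex) + yd * ρq * Q₁
          ≈⟨ solve 8 (λ Q₁ Q₀ ρq ρ₁ y′ yd Ex Ey → ρ₁ :* (y′ :* Q₀ :+ ρq :* Ex) :+ yd :* ρq :* Q₁
                                                 := y′ :* Q₀ :* ρ₁ :+ ρq :* (yd :* Q₁ :+ ρ₁ :* Ex)) refl Q₁ Q₀ ρq ρ₁ y′ yd Ex Ey ⟩
        y′ * Q₀ * ρ₁ + ρq * (yd * Q₁ + ρ₁ * Ex) ≈⟨ +-congˡ (*-congˡ (sym e₁)) ⟩
        y′ * Q₀ * ρ₁ + ρq * (x₁ * Q₂ + ρ₁ * Ey)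
          ≈⟨ solve 8 (λ Q₀ Q₂ x₁ ρq ρ₁ y′ Ex Ey → y′ :* Q₀ :* ρ₁ :+ ρq :* (x₁ :* Q₂ :+ ρ₁ :* Ey)
                                                 := y′ :* Q₀ :* ρ₁ :+ Q₂ :* ρq :* x₁ :+ ρ₁ :* ρq :* Ey) refl Q₀ Q₂ x₁ ρq ρ₁ y′ Ex Ey ⟩
        y′ * Q₀ * ρ₁ + Q₂ * ρq * x₁ + ρ₁ * ρq * Ey ∎)

      recurrence-step : ∀ Q₁ Q₀ Qp Qp′ xq xp X′ ρq ρp y′ yp Pa Pb →
        Q₁ * Pa ≈ y′ * Q₀ * Pb + Qp * ρq * X′ →
        xq * Q₁ + ρq * Ey ≈ y′ * Q₀ + ρq * Ex →
        xp * Qp′ + ρp * Ey ≈ yp * Qp + ρp * Ex →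
        Q₁ * ((xq * X′) * ρp + yp * Pa) ≈ y′ * Q₀ * (X′ * ρp + yp * Pb) + Qp′ * ρq * (X′ * xp)
      recurrence-step Q₁ Q₀ Qp Qp′ xq xp X′ ρq ρp y′ yp Pa Pb ih e₀ e₁ = ∙-cancelʳ (X′ * ρp * ρq * Ey) _ _ (begin
        Q₁ * ((xq * X′) * ρp + yp * Pa) + X′ * ρp * ρq * Ey
          ≈⟨ solve 8 (λ Q₁ xq X′ ρq ρp yp Pa Ey → Q₁ :* ((xq :* X′) :* ρp :+ yp :* Pa) :+ X′ :* ρp :* ρq :* Ey
                                                 := X′ :* ρp :* (xq :* Q₁ :+ ρq :* Ey) :+ yp :* (Q₁ :* Pa)) refl Q₁ xq X′ ρq ρp yp Pa Ey ⟩
        X′ * ρp * (xq * Q₁ + ρq * Ey) + yp * (Q₁ * Pa) ≈⟨ +-cong (*-congˡ e₀) (*-congˡ ih) ⟩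
        X′ * ρp * (y′ * Q₀ + ρq * Ex) + yp * (y′ * Q₀ * Pb + Qp * ρq * X′)
          ≈⟨ solve 10 (λ Q₀ Qp X′ ρq ρp y′ yp Pb Ex Ey → X′ :* ρp :* (y′ :* Q₀ :+ ρq :* Ex) :+ yp :* (y′ :* Q₀ :* Pb :+ Qp :* ρq :* X′)
                                                          := y′ :* Q₀ :* (X′ :* ρp :+ yp :* Pb) :+ ρq :* X′ :* (yp :* Qp :+ ρp :* Ex))
                      refl Q₀ Qp X′ ρq ρp y′ yp Pb Ex Ey ⟩
        y′ * Q₀ * (X′ * ρp + yp * Pb) + ρq * X′ * (yp * Qp + ρp * Ex) ≈⟨ +-congˡ (*-congˡ (sym e₁)) ⟩
        y′ * Q₀ * (X′ * ρp + yp * Pb) + ρq * X′ * (xp * Qp′ + ρp * Ey)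
          ≈⟨ solve 10 (λ Q₀ Qp′ xp X′ ρq ρp y′ yp Pb Ey → y′ :* Q₀ :* (X′ :* ρp :+ yp :* Pb) :+ ρq :* X′ :* (xp :* Qp′ :+ ρp :* Ey)
                                                           := y′ :* Q₀ :* (X′ :* ρp :+ yp :* Pb) :+ Qp′ :* ρq :* (X′ :* xp) :+ X′ :* ρp :* ρq :* Ey)
                      refl Q₀ Qp′ xp X′ ρq ρp y′ yp Pb Ey ⟩
        y′ * Q₀ * (X′ * ρp + yp * Pb) + Qp′ * ρq * (X′ * xp) + X′ * ρp * ρq * Ey ∎)

    Q*Psum-suc : ∀ k q →
      Q (q Z.- 1ℤ) * Psum (suc k) q ≈
      y (q Z.+ + d Z.+ 1ℤ) * Q q * Psum k (q Z.- 1ℤ) + Q ((q Z.- 1ℤ) Z.- + suc k) * ρ q * fall x (q Z.- 1ℤ) (suc k)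
    Q*Psum-suc zero q = begin
      Q (q Z.- 1ℤ) * Psum 1 q
        ≈⟨ *-congˡ (trans (Psum-sucʳ 0 q) (+-cong (*-congʳ (fall-one x q)) (*-cong (reindex y (ZP.+-identityʳ (q Z.+ + d))) (Psum-zero q)))) ⟩
      Q (q Z.- 1ℤ) * (x q * ρ (q Z.- 1ℤ) + y (q Z.+ + d) * ρ q)
        ≈⟨ recurrence-base (Q (q Z.- 1ℤ)) (Q q) (Q ((q Z.- 1ℤ) Z.- 1ℤ)) (x q) (x (q Z.- 1ℤ)) (ρ q) (ρ (q Z.- 1ℤ))
                (y (q Z.+ + d Z.+ 1ℤ)) (y (q Z.+ + d))
                (exchange q) (trans (exchange (q Z.- 1ℤ)) (+-congʳ (*-congʳ (reindex y (up q (+ d)))))) ⟩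
      y (q Z.+ + d Z.+ 1ℤ) * Q q * ρ (q Z.- 1ℤ) + Q ((q Z.- 1ℤ) Z.- 1ℤ) * ρ q * x (q Z.- 1ℤ)
        ≈⟨ +-cong (*-congˡ (sym (Psum-zero (q Z.- 1ℤ)))) (*-congˡ (sym (fall-one x (q Z.- 1ℤ)))) ⟩
      y (q Z.+ + d Z.+ 1ℤ) * Q q * Psum 0 (q Z.- 1ℤ) + Q ((q Z.- 1ℤ) Z.- 1ℤ) * ρ q * fall x (q Z.- 1ℤ) 1 ∎
      where
      up : ∀ q d → (q Z.- 1ℤ) Z.+ d Z.+ 1ℤ ≡ q Z.+ d
      up = solve-∀
    Q*Psum-suc (suc k) q = begin
      Q₁ * Psum (suc (suc k)) q
        ≈⟨ *-congˡ (trans (Psum-sucʳ (suc k) q) (+-congʳ (*-cong (fall-suc x q (suc k)) (reindex ρ (pred-assoc q (+ suc k)))))) ⟩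
      Q₁ * ((x q * X′) * ρ p + yp * Psum (suc k) q)
        ≈⟨ recurrence-step Q₁ (Q q) (Q p) (Q (p Z.- 1ℤ)) (x q) (x p) X′ (ρ q) (ρ p) (y (q Z.+ + d Z.+ 1ℤ)) yp (Psum (suc k) q) (Psum k (q Z.- 1ℤ))
                (Q*Psum-suc k q) (exchange q) (trans (exchange p) (+-congʳ (*-congʳ (reindex y (up q (+ d) (+ suc k)))))) ⟩
      y (q Z.+ + d Z.+ 1ℤ) * Q q * (X′ * ρ p + yp * Psum k (q Z.- 1ℤ)) + Q (p Z.- 1ℤ) * ρ q * (X′ * x p)
        ≈⟨ +-cong (*-congˡ (sym (trans (Psum-sucʳ k (q Z.- 1ℤ)) (+-congˡ (*-congʳ (reindex y (shift-pred q (+ d) (+ k))))))))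
                  (*-cong (*-congʳ (reindex Q (P.sym (pred-assocʳ (q Z.- 1ℤ) (+ suc k))))) (sym (fall-snoc x (q Z.- 1ℤ) (suc k)))) ⟩
      y (q Z.+ + d Z.+ 1ℤ) * Q q * Psum (suc k) (q Z.- 1ℤ) + Q ((q Z.- 1ℤ) Z.- + suc (suc k)) * ρ q * fall x (q Z.- 1ℤ) (suc (suc k)) ∎
      where
      Q₁ = Q (q Z.- 1ℤ)
      p  = (q Z.- 1ℤ) Z.- + suc k
      X′ = fall x (q Z.- 1ℤ) (suc k)
      yp = y (q Z.+ + d Z.- + suc k)
      pred-assoc : ∀ q s → q Z.- (1ℤ Z.+ s) ≡ (q Z.- 1ℤ) Z.- s
      pred-assoc = solve-∀
      up : ∀ q d s → ((q Z.- 1ℤ) Z.- s) Z.+ d Z.+ 1ℤ ≡ q Z.+ d Z.- s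
      up = solve-∀
      shift-pred : ∀ q d k → (q Z.- 1ℤ) Z.+ d Z.- k ≡ q Z.+ d Z.- (1ℤ Z.+ k)
      shift-pred = solve-∀
      pred-assocʳ : ∀ a s → a Z.- (1ℤ Z.+ s) ≡ (a Z.- s) Z.- 1ℤ
      pred-assocʳ = solve-∀

upFrom-suc : ∀ a l → upFrom a (suc l) ≡ upFrom a l ++ (a ℕ.+ l) ∷ []
upFrom-suc a zero    = P.cong (λ z → z ∷ []) (P.sym (ℕP.+-identityʳ a))
upFrom-suc a (suc l) = P.cong (a ∷_) (P.trans (upFrom-suc (suc a) l) (P.cong (λ z → upFrom (suc a) l ++ z ∷ []) (P.sym (ℕP.+-suc a l))))

length-upFrom : ∀ a l → length (upFrom a l) ≡ l
length-upFrom a zero    = P.refl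
length-upFrom a (suc l) = P.cong suc (length-upFrom (suc a) l)

module Segment {c ℓ : Level} (R : CommutativeRing c ℓ) (m : ℕ)
               (xs : ℕ → Fin (suc (suc m)) → CommutativeRing.Carrier R)
               (i j : ℕ) (i<j : i ℕ.< j) where
  open CommutativeRing R
  open Loop R (suc (suc m)) xs
  open BigOperators R (suc (suc m)) xs
  open Periodicity R (suc m) xs
  open LastVector R (suc m) xs
  open import Relation.Binary.Reasoning.Setoid setoid

  d : ℕ
  d = j ∸ i ∸ 1

  ρ : VecZ
  ρ = σseg i (j ∸ 1) (suc m ℕ.* d)

  -- With these parameters Psum k is P i j k by definition.
  open PSum R m xs (X i) ρ (X j) d public
  ρ-periodic : Periodic ρ
  ρ-periodic = σ-periodic i (upFrom (suc i) (j ∸ 1 ∸ i)) (suc m ℕ.* d)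

  open WithPeriodicity (X-periodic i) ρ-periodic (X-periodic j) public

  j∸i≡1+d : j ∸ i ≡ suc d
  j∸i≡1+d = P.sym (ℕP.m+[n∸m]≡n (ℕP.m<n⇒0<n∸m i<j))

  σseg-top≈Q : ∀ u → σseg i j (suc m ℕ.* (j ∸ i)) u ≈ Q u
  σseg-top≈Q u = begin
    σseg i j (suc m ℕ.* (j ∸ i)) u
      ≡⟨ P.cong₂ (λ l k → σ (X i) l k u) segment≡ (P.cong (suc m ℕ.*_) (P.trans j∸i≡1+d (P.cong suc (P.sym length≡d)))) ⟩
    σ (X i) (ws ++ X j ∷ []) (suc m ℕ.* suc (length ws)) u
      ≈⟨ σ-top-∷ʳ (X i) ws (X j) (X-periodic j) u ⟩
    sumN (suc (suc m)) (λ t → fall (X i) u t * σ (X i) ws (suc m ℕ.* length ws) (u Z.- + t)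
                              * prodN (suc m ∸ t) (λ s → X j (u Z.- + t Z.+ + length ws Z.- + s)))
      ≡⟨ P.cong₂ (λ a L → sumN (suc (suc m)) (λ t → fall (X i) u t * σ (X i) (map X (upFrom (suc i) a)) (suc m ℕ.* L) (u Z.- + t)
                                                 * prodN (suc m ∸ t) (λ s → X j (u Z.- + t Z.+ + L Z.- + s))))
                 (P.sym j∸1∸i≡d) length≡d ⟩
    Q u ∎
    where
    ws = map X (upFrom (suc i) d)
    length≡d : length ws ≡ d
    length≡d = P.trans (length-map X (upFrom (suc i) d)) (length-upFrom (suc i) d)
    j∸1∸i≡d : j ∸ 1 ∸ i ≡ d
    j∸1∸i≡d = P.trans (ℕP.∸-+-assoc j 1 i) (P.trans (P.cong (j ∸_) (ℕP.+-comm 1 i)) (P.sym (ℕP.∸-+-assoc j i 1)))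
    1+i+d≡j : suc i ℕ.+ d ≡ j
    1+i+d≡j = P.trans (P.sym (ℕP.+-suc i d)) (P.trans (P.cong (i ℕ.+_) (P.sym j∸i≡1+d)) (ℕP.m+[n∸m]≡n (ℕP.<⇒≤ i<j)))
    segment≡ : map X (upFrom (suc i) (j ∸ i)) ≡ ws ++ X j ∷ []
    segment≡ = P.trans (P.cong (λ l → map X (upFrom (suc i) l)) j∸i≡1+d)
                 (P.trans (P.cong (map X) (upFrom-suc (suc i) d))
                   (P.trans (map-++ X (upFrom (suc i) d) _) (P.cong (λ z → ws ++ X z ∷ []) 1+i+d≡j)))

  Q-periodic : Periodic Q
  Q-periodic a k = trans (sym (σseg-top≈Q (a Z.+ k Z.* + n)))
                         (trans (σ-periodic i (upFrom (suc i) (j ∸ i)) (suc m ℕ.* (j ∸ i)) a k) (σseg-top≈Q a))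

module Expansion {c ℓ : Level} (R : CommutativeRing c ℓ) (m : ℕ)
                 (xs : ℕ → Fin (suc (suc m)) → CommutativeRing.Carrier R)
                 (i j : ℕ) (i<j : i ℕ.< j) (r : ℤ) where
  open CommutativeRing R
  open Loop R (suc (suc m)) xs
  open BigOperators R (suc (suc m)) xs
  open Periodicity R (suc m) xs
  open Segment R m xs i j i<j
  open import Relation.Binary.Reasoning.Setoid setoid
  open import Algebra.Solver.Ring.NaturalCoefficients.Default commutativeSemiring using (solve; _:=_; _:+_; _:*_; con)

  x y : VecZ
  x = X i
  y = X j

  sh : ℤ
  sh = shift i j r

  Qs : ℕ → Carrier
  Qs t = Q (sh Z.+ + t)

  Qprod : ℕ → ℕ → Carrier
  Qprod a l = prodN l (λ u → Qs (a ℕ.+ u))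

  yprod : ℕ → Carrier
  yprod s = prodN (suc m ∸ s) (λ u → y (r Z.+ + s Z.+ 1ℤ Z.+ + u Z.+ 1ℤ))

  xprod : ℕ → Carrier
  xprod s = prodN s (λ u → x (sh Z.+ (1ℤ Z.+ + u)))

  prodZ≡prodN : ∀ a b l (f : ℤ → Carrier) → b Z.- a Z.+ 1ℤ ≡ + l → prodZ a b f ≡ prodN l (λ u → f (a Z.+ + u))
  prodZ≡prodN a b l f len = P.cong (λ z → prodN (clamp z) (λ u → f (a Z.+ + u))) len

  yprodZ≡yprod : ∀ s → s ℕ.≤ suc m → prodZ (r Z.+ + s Z.+ 1ℤ) (r Z.+ + n Z.- 1ℤ) (λ t → y (t Z.+ 1ℤ)) ≡ yprod s
  yprodZ≡yprod s s≤1+m = prodZ≡prodN (r Z.+ + s Z.+ 1ℤ) (r Z.+ + n Z.- 1ℤ) (suc m ∸ s) (λ t → y (t Z.+ 1ℤ)) (P.trans (len r (+ m) (+ s)) (P.sym (+[m∸n]≡+m-+n (suc m) s s≤1+m)))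
    where
    len : ∀ r m s → (r Z.+ (1ℤ Z.+ (1ℤ Z.+ m)) Z.- 1ℤ) Z.- (r Z.+ s Z.+ 1ℤ) Z.+ 1ℤ ≡ (1ℤ Z.+ m) Z.- s
    len = solve-∀

  xprodZ≡xprod : ∀ s → prodZ 1ℤ (+ s) (λ t → x (sh Z.+ t)) ≡ xprod s
  xprodZ≡xprod s = prodZ≡prodN 1ℤ (+ s) s (λ t → x (sh Z.+ t)) (len (+ s))
    where
    len : ∀ s → s Z.- 1ℤ Z.+ 1ℤ ≡ s
    len = solve-∀

  σprod≈Qprod : ∀ a′ l {a b} → a ≡ + a′ → b ≡ + a′ Z.+ + l Z.- 1ℤ → σprod i j r a b ≈ Qprod a′ l
  σprod≈Qprod a′ l {a} {b} a≡ b≡ = begin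
    σprod i j r a b
      ≡⟨ prodZ≡prodN a b l (λ t → σseg i j (suc m ℕ.* (j ∸ i)) (sh Z.+ t)) (P.trans (P.cong₂ (λ b a → b Z.- a Z.+ 1ℤ) b≡ a≡) (len (+ a′) (+ l))) ⟩
    prodN l (λ u → σseg i j (suc m ℕ.* (j ∸ i)) (sh Z.+ (a Z.+ + u)))
      ≈⟨ prodN-cong l (λ u → trans (σseg-top≈Q (sh Z.+ (a Z.+ + u))) (reindex Q (P.cong (λ z → sh Z.+ (z Z.+ + u)) a≡))) ⟩
    Qprod a′ l ∎
    where
    len : ∀ a l → (a Z.+ l Z.- 1ℤ) Z.- a Z.+ 1ℤ ≡ l
    len = solve-∀

  xprod≈fall : ∀ s → xprod s ≈ fall x (sh Z.+ + s) s
  xprod≈fall s = trans (prodN-cong s (λ u → reindex x (reassoc sh (+ u)))) (prodN-ascending x s sh)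
    where
    reassoc : ∀ a u → a Z.+ (1ℤ Z.+ u) ≡ a Z.+ u Z.+ 1ℤ
    reassoc = solve-∀

  T≈ : ∀ s → s ℕ.≤ suc m → T i j r s ≈ yprod s * Qprod (2 ℕ.+ s) m * ρ (sh Z.+ + s Z.+ 1ℤ) * xprod s
  T≈ s s≤1+m = *-cong (*-cong (*-cong (reflexive (yprodZ≡yprod s s≤1+m))
                                      (σprod≈Qprod (2 ℕ.+ s) m (P.cong +_ (ℕP.+-comm s 2)) (top (+ s) (+ m))))
                              refl)
                      (reflexive (xprodZ≡xprod s))
    where
    top : ∀ s m → s Z.+ (1ℤ Z.+ (1ℤ Z.+ m)) Z.- 1ℤ ≡ (1ℤ Z.+ (1ℤ Z.+ s)) Z.+ m Z.- 1ℤ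
    top = solve-∀

  top-index : ∀ {k} → k ℕ.≤ m → + n Z.- 1ℤ ≡ + (2 ℕ.+ k) Z.+ + (m ∸ k) Z.- 1ℤ
  top-index k≤m = P.cong (λ l → + suc (suc l) Z.- 1ℤ) (P.sym (ℕP.m+[n∸m]≡n k≤m))

  Qprod-suc : ∀ a l → Qprod a (suc l) ≈ Qs a * Qprod (suc a) l
  Qprod-suc a l = *-cong (reindex Qs (ℕP.+-identityʳ a)) (prodN-cong l (λ u → reindex Qs (ℕP.+-suc a u)))

  Qprod-snoc : ∀ a l → Qprod a (suc l) ≈ Qprod a l * Qs (a ℕ.+ l)
  Qprod-snoc a l = prodN-snoc l (λ u → Qs (a ℕ.+ u))

  Qprod-+ : ∀ a l₁ l₂ → Qprod a (l₁ ℕ.+ l₂) ≈ Qprod a l₁ * Qprod (a ℕ.+ l₁) l₂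
  Qprod-+ a l₁ l₂ = trans (prodN-+ l₁ l₂ (λ u → Qs (a ℕ.+ u))) (*-congˡ (prodN-cong l₂ (λ u → reindex Qs (P.sym (ℕP.+-assoc a l₁ u)))))

  Qprod-periodic : ∀ a l → Qprod (n ℕ.+ a) l ≈ Qprod a l
  Qprod-periodic a l = prodN-cong l (λ u →
    trans (reindex Q (P.trans (P.cong (λ z → sh Z.+ + z) (ℕP.+-assoc n a u)) (wrap sh (+ n) (+ (a ℕ.+ u)))))
          (Q-periodic (sh Z.+ + (a ℕ.+ u)) 1ℤ))
    where
    wrap : ∀ sh n b → sh Z.+ (n Z.+ b) ≡ (sh Z.+ b) Z.+ 1ℤ Z.* n
    wrap = solve-∀

  yprod-suc : ∀ k → k ℕ.≤ m → yprod k ≈ y (r Z.+ + k Z.+ 1ℤ Z.+ 0ℤ Z.+ 1ℤ) * yprod (suc k)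
  yprod-suc k k≤m = trans (reflexive (P.cong (λ l → prodN l (λ u → y (r Z.+ + k Z.+ 1ℤ Z.+ + u Z.+ 1ℤ))) (ℕP.+-∸-assoc 1 k≤m)))
    (*-congˡ (prodN-cong (m ∸ k) (λ u → reindex y (index r (+ k) (+ u)))))
    where
    index : ∀ r k u → r Z.+ k Z.+ 1ℤ Z.+ (1ℤ Z.+ u) Z.+ 1ℤ ≡ r Z.+ (1ℤ Z.+ k) Z.+ 1ℤ Z.+ u Z.+ 1ℤ
    index = solve-∀

  +d≡ : + d ≡ + j Z.- + i Z.- 1ℤ
  +d≡ = P.trans (+[m∸n]≡+m-+n (j ∸ i) 1 (ℕP.m<n⇒0<n∸m i<j)) (P.cong (λ z → z Z.- 1ℤ) (+[m∸n]≡+m-+n j i (ℕP.<⇒≤ i<j)))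

  -- The right-hand sides of (1) and (2), with σ_{(n-1)(j-i)}(x_i, …, x_j) = Q turning σprod into Qprod.
  Sup-closed : ℕ → Carrier
  Sup-closed k = yprod k * Qprod 1 k * Psum k (sh Z.+ + k Z.+ 1ℤ) * Qprod (2 ℕ.+ k) (m ∸ k)

  Sdown-closed : ℕ → Carrier
  Sdown-closed k = xprod (suc k) * Qprod (2 ℕ.+ k) (m ∸ k) * Psum (m ∸ k) sh * Qprod 1 k

  Qs-suc-expand : ∀ k → Qs (suc k) * Psum (suc k) (sh Z.+ + suc k Z.+ 1ℤ) ≈
    y (r Z.+ + k Z.+ 1ℤ Z.+ 0ℤ Z.+ 1ℤ) * Qs (2 ℕ.+ k) * Psum k (sh Z.+ + k Z.+ 1ℤ) + Qs 0 * ρ (sh Z.+ + suc k Z.+ 1ℤ) * fall x (sh Z.+ + suc k) (suc k)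
  Qs-suc-expand k = begin
    Qs (suc k) * Psum (suc k) q
      ≈⟨ *-congʳ (sym (reindex Q (cancel (sh Z.+ + suc k)))) ⟩
    Q (q Z.- 1ℤ) * Psum (suc k) q
      ≈⟨ Q*Psum-suc k q ⟩
    y (q Z.+ + d Z.+ 1ℤ) * Q q * Psum k (q Z.- 1ℤ) + Q ((q Z.- 1ℤ) Z.- + suc k) * ρ q * fall x (q Z.- 1ℤ) (suc k)
      ≈⟨ +-cong (*-cong (*-cong (reindex y y-index) (reindex Q (Q-index sh (+ k)))) (reindex (λ z → Psum k z) (P-index sh (+ k))))
                (*-cong (*-congʳ (reindex Q (back sh (+ suc k)))) (reindex (λ z → fall x z (suc k)) (cancel (sh Z.+ + suc k)))) ⟩
    y (r Z.+ + k Z.+ 1ℤ Z.+ 0ℤ Z.+ 1ℤ) * Qs (2 ℕ.+ k) * Psum k (sh Z.+ + k Z.+ 1ℤ) + Qs 0 * ρ q * fall x (sh Z.+ + suc k) (suc k) ∎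
    where
    q = sh Z.+ + suc k Z.+ 1ℤ
    cancel : ∀ a → a Z.+ 1ℤ Z.- 1ℤ ≡ a
    cancel = solve-∀
    Q-index : ∀ sh k → sh Z.+ (1ℤ Z.+ k) Z.+ 1ℤ ≡ sh Z.+ (1ℤ Z.+ (1ℤ Z.+ k))
    Q-index = solve-∀
    P-index : ∀ sh k → sh Z.+ (1ℤ Z.+ k) Z.+ 1ℤ Z.- 1ℤ ≡ sh Z.+ k Z.+ 1ℤ
    P-index = solve-∀
    back : ∀ sh s → sh Z.+ s Z.+ 1ℤ Z.- 1ℤ Z.- s ≡ sh Z.+ 0ℤ
    back = solve-∀
    y-index′ : ∀ r j i k → (r Z.- j Z.+ i Z.+ (1ℤ Z.+ k) Z.+ 1ℤ) Z.+ (j Z.- i Z.- 1ℤ) Z.+ 1ℤ ≡ r Z.+ k Z.+ 1ℤ Z.+ 0ℤ Z.+ 1ℤ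
    y-index′ = solve-∀
    y-index : q Z.+ + d Z.+ 1ℤ ≡ r Z.+ + k Z.+ 1ℤ Z.+ 0ℤ Z.+ 1ℤ
    y-index = P.trans (P.cong (λ z → q Z.+ z Z.+ 1ℤ) +d≡) (y-index′ r (+ j) (+ i) (+ k))

  Sup-closed-step : ∀ k → suc k ℕ.≤ m →
    Sup-closed k + yprod (suc k) * Qprod (3 ℕ.+ k) m * ρ (sh Z.+ + suc k Z.+ 1ℤ) * xprod (suc k) ≈ Sup-closed (suc k)
  Sup-closed-step k k<m = begin
    Sup-closed k + Y′ * Qprod (3 ℕ.+ k) m * ρ q * xprod (suc k)
      ≈⟨ +-cong (*-cong (*-congʳ (*-congʳ (yprod-suc k (ℕP.<⇒≤ k<m))))
                        (trans (reflexive (P.cong (Qprod (2 ℕ.+ k)) (ℕP.+-∸-assoc 1 k<m))) (Qprod-suc (2 ℕ.+ k) (m ∸ suc k))))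
                (*-cong (*-congʳ (*-congˡ wrap-around)) (xprod≈fall (suc k))) ⟩
    (y₀ * Y′) * Gk * Pk * (G₂ * G′) + Y′ * (G′ * (G₀ * Gk)) * ρ q * F
      ≈⟨ solve 9 (λ Y′ y₀ Gk Pk G₂ G′ G₀ ρq F → (y₀ :* Y′) :* Gk :* Pk :* (G₂ :* G′) :+ Y′ :* (G′ :* (G₀ :* Gk)) :* ρq :* F
                                                 := Y′ :* Gk :* G′ :* (y₀ :* G₂ :* Pk :+ G₀ :* ρq :* F))
                 refl Y′ y₀ Gk Pk G₂ G′ G₀ (ρ q) F ⟩
    Y′ * Gk * G′ * (y₀ * G₂ * Pk + G₀ * ρ q * F)
      ≈⟨ *-congˡ (sym (Qs-suc-expand k)) ⟩
    Y′ * Gk * G′ * (Qs (suc k) * Psum (suc k) q)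
      ≈⟨ solve 5 (λ Y′ Gk G′ G₁ P₁ → Y′ :* Gk :* G′ :* (G₁ :* P₁) := Y′ :* (Gk :* G₁) :* P₁ :* G′) refl Y′ Gk G′ (Qs (suc k)) (Psum (suc k) q) ⟩
    Y′ * (Gk * Qs (suc k)) * Psum (suc k) q * G′
      ≈⟨ *-congʳ (*-congʳ (*-congˡ (sym (Qprod-snoc 1 k)))) ⟩
    Sup-closed (suc k) ∎
    where
    q  = sh Z.+ + suc k Z.+ 1ℤ
    y₀ = y (r Z.+ + k Z.+ 1ℤ Z.+ 0ℤ Z.+ 1ℤ)
    Y′ = yprod (suc k)
    Gk = Qprod 1 k
    Pk = Psum k (sh Z.+ + k Z.+ 1ℤ)
    G₂ = Qs (2 ℕ.+ k)
    G′ = Qprod (3 ℕ.+ k) (m ∸ suc k)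
    G₀ = Qs 0
    F  = fall x (sh Z.+ + suc k) (suc k)
    wrap-around : Qprod (3 ℕ.+ k) m ≈ G′ * (G₀ * Gk)
    wrap-around = begin
      Qprod (3 ℕ.+ k) m                              ≡⟨ P.cong (Qprod (3 ℕ.+ k)) (P.sym (ℕP.m∸n+n≡m k<m)) ⟩
      Qprod (3 ℕ.+ k) ((m ∸ suc k) ℕ.+ suc k)        ≈⟨ Qprod-+ (3 ℕ.+ k) (m ∸ suc k) (suc k) ⟩
      G′ * Qprod ((3 ℕ.+ k) ℕ.+ (m ∸ suc k)) (suc k) ≡⟨ P.cong (λ a → G′ * Qprod a (suc k)) n+0 ⟩
      G′ * Qprod (n ℕ.+ 0) (suc k)                   ≈⟨ *-congˡ (trans (Qprod-periodic 0 (suc k)) (Qprod-suc 0 k)) ⟩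
      G′ * (G₀ * Gk)                                 ∎
      where
      n+0 : (3 ℕ.+ k) ℕ.+ (m ∸ suc k) ≡ n ℕ.+ 0
      n+0 = P.trans (P.cong (2 ℕ.+_) (ℕP.m+[n∸m]≡n k<m)) (P.sym (ℕP.+-identityʳ n))

  Sup≈Sup-closed : ∀ k → k ℕ.≤ m → Sup i j r k ≈ Sup-closed k
  Sup≈Sup-closed zero    _   = begin
    T i j r 0 + 0#                                        ≈⟨ trans (+-identityʳ _) (T≈ 0 z≤n) ⟩
    yprod 0 * Qprod 2 m * ρ (sh Z.+ + 0 Z.+ 1ℤ) * 1#      ≈⟨ solve 3 (λ a b c → a :* b :* c :* one := a :* one :* c :* b) refl (yprod 0) (Qprod 2 m) (ρ (sh Z.+ + 0 Z.+ 1ℤ)) ⟩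
    yprod 0 * 1# * ρ (sh Z.+ + 0 Z.+ 1ℤ) * Qprod 2 m      ≈⟨ *-congʳ (*-congˡ (sym (Psum-zero (sh Z.+ + 0 Z.+ 1ℤ)))) ⟩
    Sup-closed 0                                          ∎
    where one = con 1
  Sup≈Sup-closed (suc k) k<m = begin
    sumN (suc (suc k)) (T i j r)       ≈⟨ sumN-snoc (suc k) (T i j r) ⟩
    Sup i j r k + T i j r (suc k)      ≈⟨ +-cong (Sup≈Sup-closed k (ℕP.<⇒≤ k<m)) (T≈ (suc k) (ℕP.m≤n⇒m≤1+n k<m)) ⟩
    Sup-closed k + yprod (suc k) * Qprod (3 ℕ.+ k) m * ρ (sh Z.+ + suc k Z.+ 1ℤ) * xprod (suc k)
                                       ≈⟨ Sup-closed-step k k<m ⟩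
    Sup-closed (suc k)                 ∎

  Sup-full : Sup i j r (suc m) ≈ Qprod 1 (suc m)
  Sup-full = begin
    sumN (suc (suc m)) (T i j r)
      ≈⟨ sumN-snoc (suc m) (T i j r) ⟩
    Sup i j r m + T i j r (suc m)
      ≈⟨ +-cong (Sup≈Sup-closed m ℕP.≤-refl) (T≈ (suc m) ℕP.≤-refl) ⟩
    Sup-closed m + yprod (suc m) * Qprod (3 ℕ.+ m) m * ρ (sh Z.+ + suc m Z.+ 1ℤ) * xprod (suc m)
      ≈⟨ +-cong (*-cong (*-cong (*-congʳ yprod-last) (reindex (λ z → Psum m z) (reassoc sh (+ m)))) (prodN-empty (m ∸ m) (λ u → Qs (2 ℕ.+ m ℕ.+ u)) (ℕP.n∸n≡0 m)))
                (*-cong (*-cong (*-cong (prodN-empty (m ∸ m) (λ u → y (r Z.+ + suc m Z.+ 1ℤ Z.+ + u Z.+ 1ℤ)) (ℕP.n∸n≡0 m)) (trans (reflexive (P.cong (λ z → Qprod (suc (suc z)) m) (ℕP.+-comm 1 m))) (Qprod-periodic 1 m)))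
                                (trans (reindex ρ (wrap sh (+ m))) (ρ-periodic sh 1ℤ)))
                        (xprod≈fall (suc m))) ⟩
    y₀ * Qprod 1 m * Psum m (sh Z.+ + suc m) * 1# + 1# * Qprod 1 m * ρ sh * F
      ≈⟨ solve 5 (λ y₀ G P′ ρs F → y₀ :* G :* P′ :* one :+ one :* G :* ρs :* F := G :* (F :* ρs :+ y₀ :* P′)) refl y₀ (Qprod 1 m) (Psum m (sh Z.+ + suc m)) (ρ sh) F ⟩
    Qprod 1 m * (F * ρ sh + y₀ * Psum m (sh Z.+ + suc m))
      ≈⟨ *-congˡ (sym (trans (Psum-sucʳ m (sh Z.+ + suc m)) (+-cong (*-congˡ (reindex ρ (cancel sh (+ suc m)))) (*-congʳ y≈y₀)))) ⟩
    Qprod 1 m * Qs (suc m)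
      ≈⟨ sym (Qprod-snoc 1 m) ⟩
    Qprod 1 (suc m) ∎
    where
    one = con 1
    y₀ = y (r Z.+ + m Z.+ 1ℤ Z.+ 0ℤ Z.+ 1ℤ)
    F  = fall x (sh Z.+ + suc m) (suc m)
    reassoc : ∀ sh m → sh Z.+ m Z.+ 1ℤ ≡ sh Z.+ (1ℤ Z.+ m)
    reassoc = solve-∀
    wrap : ∀ sh m → sh Z.+ (1ℤ Z.+ m) Z.+ 1ℤ ≡ sh Z.+ 1ℤ Z.* (1ℤ Z.+ (1ℤ Z.+ m))
    wrap = solve-∀
    cancel : ∀ sh s → sh Z.+ s Z.- s ≡ sh
    cancel = solve-∀
    to-r : ∀ r j i m → (r Z.- j Z.+ i Z.+ (1ℤ Z.+ m)) Z.+ (j Z.- i Z.- 1ℤ) Z.- m ≡ r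
    to-r = solve-∀
    to-r+n : ∀ r m → r Z.+ m Z.+ 1ℤ Z.+ 0ℤ Z.+ 1ℤ ≡ r Z.+ 1ℤ Z.* (1ℤ Z.+ (1ℤ Z.+ m))
    to-r+n = solve-∀
    y≈y₀ : y (sh Z.+ + suc m Z.+ + d Z.- + m) ≈ y₀
    y≈y₀ = trans (reindex y (P.trans (P.cong (λ z → sh Z.+ + suc m Z.+ z Z.- + m) +d≡) (to-r r (+ j) (+ i) (+ m))))
                 (sym (trans (reindex y (to-r+n r (+ m))) (X-periodic j r 1ℤ)))
    yprod-last : yprod m ≈ y₀
    yprod-last = trans (reflexive (P.cong (λ l → prodN l (λ u → y (r Z.+ + m Z.+ 1ℤ Z.+ + u Z.+ 1ℤ))) (ℕP.m+n∸n≡m 1 m)))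
                       (*-identityʳ _)
    prodN-empty : ∀ l (f : ℕ → Carrier) → l ≡ 0 → prodN l f ≈ 1#
    prodN-empty _ f P.refl = refl

  Qs-split : ∀ k → k ℕ.≤ m → Qs (suc k) ≈ yprod k * Psum k (sh Z.+ + k Z.+ 1ℤ) + xprod (suc k) * Psum (m ∸ k) sh
  Qs-split k k≤m = trans (Psum-split k m (sh Z.+ + suc k) k≤m)
    (+-cong (*-cong y-block (reindex (λ z → Psum k z) (reassoc sh (+ k))))
            (*-cong (sym (xprod≈fall (suc k))) (reindex (λ z → Psum (m ∸ k) z) (cancel sh (+ suc k)))))
    where
    L = suc m ∸ k
    a = r Z.+ + k Z.+ 1ℤ
    reassoc : ∀ sh k → sh Z.+ (1ℤ Z.+ k) ≡ sh Z.+ k Z.+ 1ℤ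
    reassoc = solve-∀
    cancel : ∀ sh s → sh Z.+ s Z.- s ≡ sh
    cancel = solve-∀
    to-r : ∀ r j i k → (r Z.- j Z.+ i Z.+ (1ℤ Z.+ k)) Z.+ (j Z.- i Z.- 1ℤ) Z.- k ≡ r
    to-r = solve-∀
    to-a+L : ∀ r k m → r Z.+ 1ℤ Z.* (1ℤ Z.+ (1ℤ Z.+ m)) ≡ (r Z.+ k Z.+ 1ℤ) Z.+ ((1ℤ Z.+ m) Z.- k)
    to-a+L = solve-∀
    y-block : fall y (sh Z.+ + suc k Z.+ + d Z.- + k) L ≈ yprod k
    y-block = begin
      fall y (sh Z.+ + suc k Z.+ + d Z.- + k) L
        ≈⟨ reindex (λ z → fall y z L) (P.trans (P.cong (λ z → sh Z.+ + suc k Z.+ z Z.- + k) +d≡) (to-r r (+ j) (+ i) (+ k))) ⟩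
      fall y r L
        ≈⟨ sym (fall-periodic (X-periodic j) L r 1ℤ) ⟩
      fall y (r Z.+ 1ℤ Z.* + n) L
        ≈⟨ reindex (λ z → fall y z L) (P.trans (to-a+L r (+ k) (+ m)) (P.cong (λ z → a Z.+ z) (P.sym (+[m∸n]≡+m-+n (suc m) k (ℕP.m≤n⇒m≤1+n k≤m))))) ⟩
      fall y (a Z.+ + L) L
        ≈⟨ sym (prodN-ascending y L a) ⟩
      yprod k ∎

  Sdown≈Sdown-closed : ∀ k → k ℕ.≤ m → Sdown i j r (suc k) ≈ Sdown-closed k
  Sdown≈Sdown-closed k k≤m = ∙-cancelˡ (Sup i j r k) _ _ (begin
    Sup i j r k + Sdown i j r (suc k)
      ≈⟨ sym (trans (reflexive (P.cong (λ l → sumN (suc l) (T i j r)) (P.sym (ℕP.m+[n∸m]≡n k≤1+m)))) (sumN-+ (suc k) (suc m ∸ k) (T i j r))) ⟩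
    Sup i j r (suc m)
      ≈⟨ Sup-full ⟩
    Qprod 1 (suc m)
      ≈⟨ trans (reflexive (P.cong (Qprod 1) 1+m≡)) (trans (Qprod-+ 1 k (suc (m ∸ k))) (*-congˡ (Qprod-suc (suc k) (m ∸ k)))) ⟩
    Qprod 1 k * (Qs (suc k) * Qprod (2 ℕ.+ k) (m ∸ k))
      ≈⟨ *-congˡ (*-congʳ (Qs-split k k≤m)) ⟩
    Qprod 1 k * ((yprod k * Pk + xprod (suc k) * Pm) * Qprod (2 ℕ.+ k) (m ∸ k))
      ≈⟨ solve 6 (λ Gk Y Pk B Pm G → Gk :* ((Y :* Pk :+ B :* Pm) :* G) := Y :* Gk :* Pk :* G :+ B :* G :* Pm :* Gk)
                 refl (Qprod 1 k) (yprod k) Pk (xprod (suc k)) Pm (Qprod (2 ℕ.+ k) (m ∸ k)) ⟩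
    Sup-closed k + Sdown-closed k
      ≈⟨ +-congʳ (sym (Sup≈Sup-closed k k≤m)) ⟩
    Sup i j r k + Sdown-closed k ∎)
    where
    open import Algebra.Properties.Group +-group using (∙-cancelˡ)
    Pk = Psum k (sh Z.+ + k Z.+ 1ℤ)
    Pm = Psum (m ∸ k) sh
    k≤1+m = ℕP.m≤n⇒m≤1+n k≤m
    1+m≡ : suc m ≡ k ℕ.+ suc (m ∸ k)
    1+m≡ = P.trans (P.cong suc (P.sym (ℕP.m+[n∸m]≡n k≤m))) (P.sym (ℕP.+-suc k (m ∸ k)))

  part₁ : ∀ k → k ℕ.≤ m →
    Sup i j r k ≈ prodZ (r Z.+ + k Z.+ 1ℤ) (r Z.+ + n Z.- 1ℤ) (λ t → X j (t Z.+ 1ℤ)) * σprod i j r 1ℤ (+ k)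
                  * P i j k (shift i j r Z.+ + k Z.+ 1ℤ) * σprod i j r (+ k Z.+ + 2) (+ n Z.- 1ℤ)
  part₁ k k≤m = trans (Sup≈Sup-closed k k≤m) (sym (*-cong (*-cong (*-cong (reflexive (yprodZ≡yprod k (ℕP.m≤n⇒m≤1+n k≤m)))
                                                                           (σprod≈Qprod 1 k P.refl (add-sub (+ k))))
                                                                   refl)
                                                           (σprod≈Qprod (2 ℕ.+ k) (m ∸ k) (P.cong +_ (ℕP.+-comm k 2)) (top-index k≤m))))
    where
    add-sub : ∀ k → k ≡ 1ℤ Z.+ k Z.- 1ℤ
    add-sub = solve-∀

  part₂ : ∀ k → k ℕ.≤ m →
    Sdown i j r (suc k) ≈ prodZ 1ℤ (+ suc k) (λ t → X i (shift i j r Z.+ t)) * σprod i j r (+ suc k Z.+ 1ℤ) (+ n Z.- 1ℤ)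
                          * P i j (n ∸ suc k ∸ 1) (shift i j r) * σprod i j r 1ℤ (+ suc k Z.- 1ℤ)
  part₂ k k≤m = trans (Sdown≈Sdown-closed k k≤m) (sym (*-cong (*-cong (*-cong (reflexive (xprodZ≡xprod (suc k)))
                                                                              (σprod≈Qprod (2 ℕ.+ k) (m ∸ k) (P.cong +_ (ℕP.+-comm (suc k) 1)) (top-index k≤m)))
                                                                      (reflexive (P.cong (λ l → Psum l sh) degree)))
                                                              (σprod≈Qprod 1 k P.refl P.refl)))
    where
    degree : n ∸ suc k ∸ 1 ≡ m ∸ k
    degree = P.trans (ℕP.∸-+-assoc (suc m) k 1) (P.cong (suc m ∸_) (ℕP.+-comm k 1))

  part₃ : Sup i j r (suc m) ≈ σprod i j r 1ℤ (+ n Z.- 1ℤ)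
  part₃ = trans Sup-full (sym (σprod≈Qprod 1 (suc m) P.refl P.refl))

-- The development above needs n ≥ 2; for n = 1 every product in T_0 is empty.
module OneVariable {c ℓ : Level} (R : CommutativeRing c ℓ) (xs : ℕ → Fin 1 → CommutativeRing.Carrier R) where
  open CommutativeRing R
  open Loop R 1 xs
  open LastVector R 0 xs using (τ-zero)

  Sup-zero : ∀ i j r → Sup i j r 0 ≈ σprod i j r 1ℤ (+ 1 Z.- 1ℤ)
  Sup-zero i j r = trans (+-identityʳ _)
    (trans (*-cong (*-cong (*-cong (reflexive (P.cong (λ l → prodN (clamp l) (λ u → X j (r Z.+ + 0 Z.+ 1ℤ Z.+ + u Z.+ 1ℤ))) (len r))) refl)
                           (trans (+-identityʳ _) (trans (*-identityˡ _) (τ-zero (map X (upFrom (suc i) (j ∸ 1 ∸ i))) _))))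
                   refl)
           (trans (*-identityʳ _) (trans (*-identityʳ _) (*-identityʳ _))))
    where
    len : ∀ r → (r Z.+ + 1 Z.- 1ℤ) Z.- (r Z.+ + 0 Z.+ 1ℤ) Z.+ 1ℤ ≡ + 0
    len = solve-∀

mainTheorem8 : ∀ {c ℓ : Level} (R : CommutativeRing c ℓ) (n m : ℕ) .{{_ : NonZero n}} → 1 ≤ m →
    (x : ℕ → Fin n → CommutativeRing.Carrier R) →
    let open CommutativeRing R
        open Loop R n x
    in ∀ (i j : ℕ) → 1 ≤ i → i < j → j ≤ m → (r : ℤ) →
      (∀ (k : ℕ) → k < n ∸ 1 →
        Sup i j r k ≈
          prodZ (r Z.+ + k Z.+ 1ℤ) (r Z.+ + n Z.- 1ℤ) (λ t → X j (t Z.+ 1ℤ))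
          * σprod i j r 1ℤ (+ k)
          * P i j k (shift i j r Z.+ + k Z.+ 1ℤ)
          * σprod i j r (+ k Z.+ + 2) (+ n Z.- 1ℤ))
      × (∀ (k : ℕ) → 0 < k → k ≤ n ∸ 1 →
        Sdown i j r k ≈
          prodZ 1ℤ (+ k) (λ t → X i (shift i j r Z.+ t))
          * σprod i j r (+ k Z.+ 1ℤ) (+ n Z.- 1ℤ)
          * P i j (n ∸ k ∸ 1) (shift i j r)
          * σprod i j r 1ℤ (+ k Z.- 1ℤ))
      × (Sup i j r (n ∸ 1) ≈ σprod i j r 1ℤ (+ n Z.- 1ℤ))
      × (Sdown i j r 0 ≈ σprod i j r 1ℤ (+ n Z.- 1ℤ))
mainTheorem8 R zero          _ {{n≢0}} _ x = Irrelevant.⊥-elim (NonZero.nonZero n≢0)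
mainTheorem8 R (suc zero)    _ _ x i j _ _ _ r =
  (λ _ ()) , (λ { zero () ; (suc _) _ () }) , Sup-zero i j r , Sup-zero i j r
  where open OneVariable R x
mainTheorem8 R (suc (suc m)) _ _ x i j _ i<j _ r =
  (λ k k<1+m → part₁ k (ℕP.≤-pred k<1+m)) ,
  (λ { zero () ; (suc k) _ k<1+m → part₂ k (ℕP.≤-pred k<1+m) }) ,
  part₃ , part₃
  where open Expansion R m x i j i<j r
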